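{- Let $l,m,n\ge 0$ be integers and let $\Sigma=(-K_l)\vee_{+}(+K_m)\vee_{+}(-K_n)$. Then \[ \mathsf E(\Sigma,x)=H_1(l,m,n,x), \] \[ \mathsf O(\Sigma,x)=\mathsf E(\Sigma,x-1)+l\,H_1(l-1,m,n,x-1)+m\,H_1(l,m-1,n,x-1)+n\,H_1(l,m,n-1,x-1). \]
   Context: A signed graph $\Sigma=(\Gamma,\sigma)$ is a finite simple graph $\Gamma$ with a signature $\sigma:E(\Gamma)\to\{\pm1\}$. $+K_n$ (resp. $-K_n$) is the complete graph on $n$ vertices with all edges positive (resp. negative); $K_0$ is the empty signed graph. For signed graphs $\Sigma_1,\Sigma_2$ on disjoint vertex sets, the all-positive join $\Sigma_1\vee_{+}\Sigma_2$ is obtained from their disjoint union by joining every vertex of $\Sigma_1$ to every vertex of $\Sigma_2$ by a positive edge (this operation is associative, and joining with $K_0$ does nothing). For an integer $\lambda\ge 0$, let $C_\lambda$ be the set of nonzero integers in $[-\lambda/2,\lambda/2]$ if $\lambda$ is even, and the set of integers in $[-(\lambda-1)/2,(\lambda-1)/2]$ if $\lambda$ is odd. A proper $C_\lambda$-colouring of $\Sigma$ is a map $\kappa:V(\Gamma)\to C_\lambda$ with $\kappa(v)\ne\sigma(\{v,w\})\kappa(w)$ for every edge $\{v,w\}$; $f(\Sigma,\lambda)$ denotes their number. $\mathsf E(\Sigma,x),\mathsf O(\Sigma,x)\in\mathbb Z[x]$ are the unique polynomials with $f(\Sigma,\lambda)=\mathsf E(\Sigma,\lambda)$ for all even $\lambda\ge0$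 and $f(\Sigma,\lambda)=\mathsf O(\Sigma,\lambda)$ for all odd $\lambda\ge0$. Notation: $(x)_n=\prod_{j=0}^{n-1}(x-j)$ and ${}_2(x)_n=\prod_{j=0}^{n-1}(x-2j)$ (both equal $1$ for $n=0$); $S(n,k)$ is the Stirling number of the second kind (number of partitions of an $n$-set into $k$ nonempty blocks, $S(0,0)=1$). For integers $l,m,n\ge0$, \[ H_1(l,m,n,x)=\sum_{i=0}^{l}\sum_{j=0}^{n}\sum_{k=0}^{\min(i,j)} k!\binom{i}{k}\binom{j}{k}S(l,i)S(n,j)\,{}_2(x)_{i+j-k}\,(x-i-j)_m, \] and $H_1(l,m,n,x)=0$ if any of $l,m,n$ is negative. -}

module Defs where

open import Data.Nat as ℕ using (ℕ; zero; suc; ⌊_/2⌋)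
open import Data.Nat.Base using (_!)
open import Data.Nat.Combinatorics using (_C_)
open import Relation.Nullary using (yes; no)
open import Data.Empty using (⊥-elim)
open import Relation.Binary.PropositionalEquality using (refl; sym)
open import Data.Integer as ℤ using (ℤ; +_; -[1+_]; _+_; _*_; _-_; -_)
open import Data.Fin using (Fin; splitAt; _≟_)
open import Data.Sum using (_⊎_; inj₁; inj₂)
open import Data.List using (List; []; _∷_; _++_; length; filter; map; concatMap; foldr; allFin)
open import Data.Vec.Functional using (Vector)
open import Data.Bool using (Bool; true; false; _∧_; not; if_then_else_)
open import Relation.Nullary.Decidable using (does; ⌊_⌋)
open import Relation.Binary.PropositionalEquality using (_≡_)

data EdgeLabel : Set where
  none pos neg : EdgeLabel

record SignedGraph : Set where
  field
    N    : ℕ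
    edge : Fin N → Fin N → EdgeLabel
    symm : ∀ i j → edge i j ≡ edge j i
    irr  : ∀ i → edge i i ≡ none
open SignedGraph public

Kedge : ∀ {n} → EdgeLabel → Fin n → Fin n → EdgeLabel
Kedge s i j = if does (i ≟ j) then none else s

joinEdge : ∀ {a b} → (Fin a → Fin a → EdgeLabel) → (Fin b → Fin b → EdgeLabel)
         → Fin (a ℕ.+ b) → Fin (a ℕ.+ b) → EdgeLabel
joinEdge {a} e₁ e₂ i j with splitAt a i | splitAt a j
... | inj₁ x | inj₁ y = e₁ x y
... | inj₂ x | inj₂ y = e₂ x y
... | inj₁ _ | inj₂ _ = pos
... | inj₂ _ | inj₁ _ = pos

private
  Kedge-symm : ∀ {n} s (i j : Fin n) → Kedge s i j ≡ Kedge s j i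
  Kedge-symm s i j with i ≟ j | j ≟ i
  ... | yes _ | yes _ = refl
  ... | no _  | no _  = refl
  ... | yes p | no q  = ⊥-elim (q (sym p))
  ... | no q  | yes p = ⊥-elim (q (sym p))

  Kedge-irr : ∀ {n} s (i : Fin n) → Kedge s i i ≡ none
  Kedge-irr s i with i ≟ i
  ... | yes _ = refl
  ... | no q = ⊥-elim (q refl)

+K : ℕ → SignedGraph
+K n = record { N = n ; edge = Kedge pos ; symm = Kedge-symm pos ; irr = Kedge-irr pos }

-K : ℕ → SignedGraph
-K n = record { N = n ; edge = Kedge neg ; symm = Kedge-symm neg ; irr = Kedge-irr neg }

_∨₊_ : SignedGraph → SignedGraph → SignedGraph
Σ₁ ∨₊ Σ₂ = record { N = N Σ₁ ℕ.+ N Σ₂ ; edge = joinEdge (edge Σ₁) (edge Σ₂)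
                   ; symm = sy ; irr = ir }
  where
  sy : ∀ i j → joinEdge (edge Σ₁) (edge Σ₂) i j ≡ joinEdge (edge Σ₁) (edge Σ₂) j i
  sy i j with splitAt (N Σ₁) i | splitAt (N Σ₁) j
  ... | inj₁ x | inj₁ y = symm Σ₁ x y
  ... | inj₂ x | inj₂ y = symm Σ₂ x y
  ... | inj₁ _ | inj₂ _ = refl
  ... | inj₂ _ | inj₁ _ = refl
  ir : ∀ i → joinEdge (edge Σ₁) (edge Σ₂) i i ≡ none
  ir i with splitAt (N Σ₁) i
  ... | inj₁ x = irr Σ₁ x
  ... | inj₂ x = irr Σ₂ x
infixl 5 _∨₊_

pos-upto : ℕ → List ℤ
pos-upto zero = []
pos-upto (suc k) = pos-upto k ++ (+ suc k ∷ [])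

isOdd : ℕ → Bool
isOdd zero = false
isOdd (suc n) = not (isOdd n)

colours : ℕ → List ℤ
colours t = map -_ (pos-upto ⌊ t /2⌋)
            ++ (if isOdd t then (+ 0 ∷ []) else [])
            ++ pos-upto ⌊ t /2⌋

allMaps : ∀ {A : Set} → List A → (N : ℕ) → List (Fin N → A)
allMaps xs zero = (λ ()) ∷ []
allMaps xs (suc N) =
  concatMap (λ c → map (λ κ → λ { Fin.zero → c ; (Fin.suc i) → κ i }) (allMaps xs N)) xs
  where import Data.Fin as Fin

okPair : EdgeLabel → ℤ → ℤ → Bool
okPair none a b = true
okPair pos  a b = not ⌊ a ℤ.≟ b ⌋
okPair neg  a b = not ⌊ a ℤ.≟ - b ⌋

isProper : (Σ : SignedGraph) → (Fin (N Σ) → ℤ) → Bool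
isProper Σ κ = foldr _∧_ true
  (concatMap (λ v → map (λ w → okPair (edge Σ v w) (κ v) (κ w)) (allFin (N Σ))) (allFin (N Σ)))

f : SignedGraph → ℕ → ℕ
f Σ t = length (filter (λ κ → isProper Σ κ Data.Bool.≟ true) (allMaps (colours t) (N Σ)))
  where import Data.Bool

-- Integer polynomials as coefficient lists (constant term first)

Poly : Set
Poly = List ℤ

eval : Poly → ℤ → ℤ
eval [] x = + 0
eval (c ∷ cs) x = c + x * eval cs x

sumTo : ℕ → (ℕ → ℤ) → ℤ
sumTo zero g = g 0
sumTo (suc n) g = sumTo n g + g (suc n)

falling : ℤ → ℕ → ℤ
falling x zero = + 1
falling x (suc n) = falling x n * (x - + n)

falling2 : ℤ → ℕ → ℤ
falling2 x zero = + 1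
falling2 x (suc n) = falling2 x n * (x - + (2 ℕ.* n))

S : ℕ → ℕ → ℕ
S zero zero = 1
S zero (suc k) = 0
S (suc n) zero = 0
S (suc n) (suc k) = suc k ℕ.* S n (suc k) ℕ.+ S n k

H₁ℕ : ℕ → ℕ → ℕ → ℤ → ℤ
H₁ℕ l m n x =
  sumTo l λ i → sumTo n λ j → sumTo (ℕ._⊓_ i j) λ k →
    + ((k !) ℕ.* (i C k) ℕ.* (j C k) ℕ.* S l i ℕ.* S n j)
    * falling2 x (i ℕ.+ j ℕ.∸ k) * falling (x - + (i ℕ.+ j)) m

-- H_1 with integer arguments, zero if any of l, m, n is negative
H₁ : ℤ → ℤ → ℤ → ℤ → ℤ
H₁ (+ l) (+ m) (+ n) x = H₁ℕ l m n x
H₁ _ _ _ x = + 0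

-- Colour the vertices one at a time. For a colour pair ±a only its occupancy matters (which of the
-- cliques L = -K_l, M = +K_m, N = -K_n use +a and -a), so the number of colourings obeys a linear
-- recursion in the numbers of pairs of each occupancy. Colouring the L-vertices first, then the M-,
-- then the N-vertices, each stage is solved in closed form: L- and N-vertices either join an existing
-- block or open a new one (an r-Stirling transform), and the free colours of an M-vertex give a falling
-- factorial. For λ = 2K the result is H₁(l, m, n, 2K). For λ = 2K + 1 the extra colour 0 is used by at
-- most one vertex, which yields the removal formula at x - 1 = 2K. Both sides are polynomials that
-- agree at infinitely many points, hence everywhere.

module Submission where

open import Defs
open import Data.Nat using (ℕ)
open import Data.Integer using (ℤ; +_; _+_; _*_; _-_)
open import Data.Product using (_×_)
open import Data.Bool using (true; false)
open import Relation.Binary.PropositionalEquality using (_≡_)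

open import Data.Bool using (Bool; _∧_; not; if_then_else_)
import Data.Bool as Bool
open import Data.Bool.ListAction using (and)
open import Data.Bool.Properties using (∧-comm; ∧-assoc; ∧-idem; ∧-identityʳ; ∧-zeroʳ)
open import Data.Empty using (⊥-elim)
open import Data.Fin using (Fin; zero; suc; splitAt; join)
import Data.Fin as Fin
import Data.Fin.Properties as Finₚ
open import Data.Integer using (-[1+_]; -_; 0ℤ; 1ℤ)
open import Data.Integer.Properties
open import Data.Integer.Tactic.RingSolver using (solve-∀)
open import Data.List using (List; []; _∷_; _++_; map; replicate; concatMap; tabulate; filter; length)
open import Data.List.Properties using (filter-++; length-++; length-map; ++-identityʳ; ++-assoc)
open import Data.Maybe using (Maybe; nothing; just)
open import Data.Nat as ℕ using (zero; suc; _!; ⌊_/2⌋)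
open import Data.Nat.Combinatorics using (_C_; nCk+nC[k+1]≡[n+1]C[k+1]; k>n⇒nCk≡0)
import Data.Nat.Properties as ℕₚ
import Data.Nat.Tactic.RingSolver as ℕSolver
open import Data.Product using (_,_; proj₁; proj₂; swap; ∃-syntax)
open import Data.Sum using (_⊎_; inj₁; inj₂; [_,_]′)
import Data.Sum as Sum
open import Function using (_∘_; id; const)
open import Function.Bundles using (_⇔_; mk⇔)
open import Function.Definitions using (Injective)
open import Relation.Nullary using (Dec; yes; no)
open import Relation.Nullary.Decidable using (⌊_⌋; isYes≗does; dec-true; dec-false; does-⇔)
open import Relation.Binary.PropositionalEquality
open ≡-Reasoning

sumTo-cong : ∀ n {g h : ℕ → ℤ} → (∀ k → g k ≡ h k) → sumTo n g ≡ sumTo n h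
sumTo-cong zero    g≡h = g≡h 0
sumTo-cong (suc n) g≡h = cong₂ _+_ (sumTo-cong n g≡h) (g≡h (suc n))

sumTo-cong-≤ : ∀ n {g h : ℕ → ℤ} → (∀ k → k ℕ.≤ n → g k ≡ h k) → sumTo n g ≡ sumTo n h
sumTo-cong-≤ zero    g≡h = g≡h 0 ℕ.z≤n
sumTo-cong-≤ (suc n) g≡h =
  cong₂ _+_ (sumTo-cong-≤ n (λ k k≤n → g≡h k (ℕₚ.m≤n⇒m≤1+n k≤n))) (g≡h (suc n) ℕₚ.≤-refl)

sumTo-+ : ∀ n (g h : ℕ → ℤ) → sumTo n (λ k → g k + h k) ≡ sumTo n g + sumTo n h
sumTo-+ zero    g h = refl
sumTo-+ (suc n) g h = begin
  sumTo n (λ k → g k + h k) + (g (suc n) + h (suc n))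
    ≡⟨ cong (_+ (g (suc n) + h (suc n))) (sumTo-+ n g h) ⟩
  sumTo n g + sumTo n h + (g (suc n) + h (suc n))
    ≡⟨ swap-middle (sumTo n g) (sumTo n h) (g (suc n)) (h (suc n)) ⟩
  sumTo n g + g (suc n) + (sumTo n h + h (suc n)) ∎
  where
  swap-middle : ∀ a b c d → a + b + (c + d) ≡ a + c + (b + d)
  swap-middle = solve-∀

*-sumTo : ∀ n c (g : ℕ → ℤ) → c * sumTo n g ≡ sumTo n (λ k → c * g k)
*-sumTo zero    c g = refl
*-sumTo (suc n) c g =
  trans (*-distribˡ-+ c (sumTo n g) (g (suc n))) (cong (_+ c * g (suc n)) (*-sumTo n c g))

sumTo-suc : ∀ n (g : ℕ → ℤ) → sumTo (suc n) g ≡ g 0 + sumTo n (λ k → g (suc k))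
sumTo-suc zero    g = refl
sumTo-suc (suc n) g = trans (cong (_+ g (suc (suc n))) (sumTo-suc n g)) (+-assoc (g 0) _ _)

sumTo-vanishing-tail : ∀ {m n} (g : ℕ → ℤ) → m ℕ.≤ n → (∀ k → m ℕ.< k → g k ≡ 0ℤ) →
                       sumTo n g ≡ sumTo m g
sumTo-vanishing-tail {m} {zero} g ℕ.z≤n g0 = refl
sumTo-vanishing-tail {m} {suc n} g m≤1+n g0 with m ℕ.≟ suc n
... | yes refl = refl
... | no m≢1+n = begin
  sumTo n g + g (suc n)   ≡⟨ cong₂ _+_ (sumTo-vanishing-tail g m≤n g0) (g0 (suc n) (ℕ.s≤s m≤n)) ⟩
  sumTo m g + 0ℤ          ≡⟨ +-identityʳ _ ⟩
  sumTo m g               ∎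
  where m≤n = ℕₚ.≤-pred (ℕₚ.≤∧≢⇒< m≤1+n m≢1+n)

falling-suc : ∀ x m → falling x (suc m) ≡ x * falling (x - 1ℤ) m
falling-suc x zero    = ring x
  where ring : ∀ x → 1ℤ * (x - 0ℤ) ≡ x * 1ℤ
        ring = solve-∀
falling-suc x (suc m) =
  trans (cong (_* (x - + suc m)) (falling-suc x m)) (ring x (falling (x - 1ℤ) m) (+ m))
  where ring : ∀ x a p → x * a * (x - (1ℤ + p)) ≡ x * (a * (x - 1ℤ - p))
        ring = solve-∀

falling2-suc : ∀ x m → falling2 x (suc m) ≡ x * falling2 (x - + 2) m
falling2-suc x zero    = ring x
  where ring : ∀ x → 1ℤ * (x - 0ℤ) ≡ x * 1ℤ
        ring = solve-∀
falling2-suc x (suc m) = begin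
  falling2 x (suc m) * (x - + (2 ℕ.* suc m))
    ≡⟨ cong₂ _*_ (falling2-suc x m) (cong (λ k → x - + k) (ℕₚ.*-distribˡ-+ 2 1 m)) ⟩
  x * falling2 (x - + 2) m * (x - (+ 2 + + (2 ℕ.* m)))
    ≡⟨ ring x (falling2 (x - + 2) m) (+ (2 ℕ.* m)) ⟩
  x * (falling2 (x - + 2) m * (x - + 2 - + (2 ℕ.* m))) ∎
  where ring : ∀ x a p → x * a * (x - (+ 2 + p)) ≡ x * (a * (x - + 2 - p))
        ring = solve-∀

falling2-+ : ∀ x i r → falling2 x i * falling2 (x - + (2 ℕ.* i)) r ≡ falling2 x (i ℕ.+ r)
falling2-+ x i zero    = trans (*-identityʳ _) (cong (falling2 x) (sym (ℕₚ.+-identityʳ i)))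
falling2-+ x i (suc r) = begin
  falling2 x i * (falling2 (x - + (2 ℕ.* i)) r * (x - + (2 ℕ.* i) - + (2 ℕ.* r)))
    ≡⟨ sym (*-assoc (falling2 x i) _ _) ⟩
  falling2 x i * falling2 (x - + (2 ℕ.* i)) r * (x - + (2 ℕ.* i) - + (2 ℕ.* r))
    ≡⟨ cong₂ _*_ (falling2-+ x i r) (ring x (+ (2 ℕ.* i)) (+ (2 ℕ.* r))) ⟩
  falling2 x (i ℕ.+ r) * (x - (+ (2 ℕ.* i) + + (2 ℕ.* r)))
    ≡⟨ cong (λ k → falling2 x (i ℕ.+ r) * (x - + k)) (sym (ℕₚ.*-distribˡ-+ 2 i r)) ⟩
  falling2 x (i ℕ.+ r) * (x - + (2 ℕ.* (i ℕ.+ r)))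
    ≡⟨ cong (falling2 x) (sym (ℕₚ.+-suc i r)) ⟩
  falling2 x (i ℕ.+ suc r) ∎
  where ring : ∀ x a b → x - a - b ≡ x - (a + b)
        ring = solve-∀

falling-pascal : ∀ x k → falling (x + 1ℤ) (suc k) ≡ falling x (suc k) + + suc k * falling x k
falling-pascal x k = begin
  falling (x + 1ℤ) (suc k)              ≡⟨ falling-suc (x + 1ℤ) k ⟩
  (x + 1ℤ) * falling (x + 1ℤ - 1ℤ) k    ≡⟨ cong (λ y → (x + 1ℤ) * falling y k) (ring₁ x) ⟩
  (x + 1ℤ) * falling x k                ≡⟨ ring₂ x (falling x k) (+ k) ⟩
  falling x k * (x - + k) + (1ℤ + + k) * falling x k ∎
  where ring₁ : ∀ x → x + 1ℤ - 1ℤ ≡ x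
        ring₁ = solve-∀
        ring₂ : ∀ x a p → (x + 1ℤ) * a ≡ a * (x - p) + (1ℤ + p) * a
        ring₂ = solve-∀

falling-ℕ : ∀ i k → falling (+ i) k ≡ + (k ! ℕ.* (i C k))
falling-ℕ zero    zero    = refl
falling-ℕ zero    (suc k) = begin
  falling 0ℤ (suc k)              ≡⟨ falling-suc 0ℤ k ⟩
  0ℤ * falling (0ℤ - 1ℤ) k        ≡⟨ *-zeroˡ (falling (0ℤ - 1ℤ) k) ⟩
  0ℤ                              ≡⟨ cong +_ (sym (ℕₚ.*-zeroʳ (suc k !))) ⟩
  + (suc k ! ℕ.* 0)               ∎
falling-ℕ (suc i) zero    = refl
falling-ℕ (suc i) (suc k) = begin
  falling (+ suc i) (suc k)
    ≡⟨ cong (λ j → falling (+ j) (suc k)) (ℕₚ.+-comm 1 i) ⟩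
  falling (+ i + 1ℤ) (suc k)
    ≡⟨ falling-pascal (+ i) k ⟩
  falling (+ i) (suc k) + + suc k * falling (+ i) k
    ≡⟨ cong₂ (λ a b → a + + suc k * b) (falling-ℕ i (suc k)) (falling-ℕ i k) ⟩
  + (suc k ! ℕ.* (i C suc k)) + + suc k * + (k ! ℕ.* (i C k))
    ≡⟨ cong (_+_ (+ (suc k ! ℕ.* (i C suc k)))) (sym (pos-* (suc k) (k ! ℕ.* (i C k)))) ⟩
  + (suc k ! ℕ.* (i C suc k) ℕ.+ suc k ℕ.* (k ! ℕ.* (i C k)))
    ≡⟨ cong +_ (ring (suc k) (k !) (i C suc k) (i C k)) ⟩
  + (suc k ! ℕ.* (i C k ℕ.+ i C suc k))
    ≡⟨ cong (λ c → + (suc k ! ℕ.* c)) (nCk+nC[k+1]≡[n+1]C[k+1] i k) ⟩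
  + (suc k ! ℕ.* (suc i C suc k)) ∎
  where ring : ∀ s f a b → s ℕ.* f ℕ.* a ℕ.+ s ℕ.* (f ℕ.* b) ≡ s ℕ.* f ℕ.* (b ℕ.+ a)
        ring = ℕSolver.solve-∀

-- r-Stirling numbers and Stirling transforms

-- rStirling d n j: distributions of n elements into d labelled, possibly empty blocks and j further
-- nonempty unlabelled blocks (the r-Stirling number with r = d); the recursion places the first element.
rStirling : ℤ → ℕ → ℕ → ℤ
rStirling d zero    zero    = 1ℤ
rStirling d zero    (suc j) = 0ℤ
rStirling d (suc n) zero    = d * rStirling d n zero
rStirling d (suc n) (suc j) = d * rStirling d n (suc j) + rStirling (d + 1ℤ) n j

rStirling-vanishing : ∀ d {n j} → n ℕ.< j → rStirling d n j ≡ 0ℤ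
rStirling-vanishing d {zero}  {suc j} _ = refl
rStirling-vanishing d {suc n} {suc j} (ℕ.s≤s n<j) = begin
  d * rStirling d n (suc j) + rStirling (d + 1ℤ) n j
    ≡⟨ cong₂ (λ a b → d * a + b) (rStirling-vanishing d (ℕₚ.m<n⇒m<1+n n<j))
                                  (rStirling-vanishing (d + 1ℤ) n<j) ⟩
  d * 0ℤ + 0ℤ
    ≡⟨ cong (_+ 0ℤ) (*-zeroʳ d) ⟩
  0ℤ ∎

rStirling-suc : ∀ d n j →
  rStirling d (suc n) (suc j) ≡ (d + + suc j) * rStirling d n (suc j) + rStirling d n j
rStirling-suc d zero    zero    = ring d
  where ring : ∀ d → d * 0ℤ + 1ℤ ≡ (d + 1ℤ) * 0ℤ + 1ℤ
        ring = solve-∀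
rStirling-suc d zero    (suc j) = ring d (+ suc (suc j))
  where ring : ∀ d x → d * 0ℤ + 0ℤ ≡ (d + x) * 0ℤ + 0ℤ
        ring = solve-∀
rStirling-suc d (suc n) zero    =
  trans (cong (λ t → d * t + (d + 1ℤ) * rStirling (d + 1ℤ) n 0) (rStirling-suc d n 0))
        (ring d (rStirling d n 1) (rStirling d n 0) (rStirling (d + 1ℤ) n 0))
  where ring : ∀ d a b c → d * ((d + 1ℤ) * a + b) + (d + 1ℤ) * c ≡ (d + 1ℤ) * (d * a + c) + d * b
        ring = solve-∀
rStirling-suc d (suc n) (suc j) =
  trans (cong₂ (λ t u → d * t + u) (rStirling-suc d n (suc j)) (rStirling-suc (d + 1ℤ) n j))
        (ring d (+ j) (rStirling d n (suc (suc j))) (rStirling d n (suc j))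
                      (rStirling (d + 1ℤ) n (suc j)) (rStirling (d + 1ℤ) n j))
  where ring : ∀ d p a b c e → d * ((d + (1ℤ + (1ℤ + p))) * a + b) + ((d + 1ℤ + (1ℤ + p)) * c + e)
                             ≡ (d + (1ℤ + (1ℤ + p))) * (d * a + c) + (d * b + e)
        ring = solve-∀

rStirling-0≡S : ∀ n j → rStirling 0ℤ n j ≡ + S n j
rStirling-0≡S zero    zero    = refl
rStirling-0≡S zero    (suc j) = refl
rStirling-0≡S (suc n) zero    = *-zeroˡ (rStirling 0ℤ n 0)
rStirling-0≡S (suc n) (suc j) = begin
  rStirling 0ℤ (suc n) (suc j)
    ≡⟨ rStirling-suc 0ℤ n j ⟩
  (0ℤ + + suc j) * rStirling 0ℤ n (suc j) + rStirling 0ℤ n j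
    ≡⟨ cong₂ (λ a b → + suc j * a + b) (rStirling-0≡S n (suc j)) (rStirling-0≡S n j) ⟩
  + suc j * + S n (suc j) + + S n j
    ≡⟨ cong (_+ + S n j) (sym (pos-* (suc j) (S n (suc j)))) ⟩
  + S (suc n) (suc j) ∎

rStirling-sumTo-suc : ∀ d n (q : ℕ → ℤ) →
  sumTo (suc n) (λ j → rStirling d (suc n) j * q j)
    ≡ d * sumTo n (λ j → rStirling d n j * q j) + sumTo n (λ j → rStirling (d + 1ℤ) n j * q (suc j))
rStirling-sumTo-suc d n q = begin
  sumTo (suc n) (λ j → rStirling d (suc n) j * q j)
    ≡⟨ sumTo-suc n _ ⟩
  d * T 0 * q 0 + sumTo n (λ j → (d * T (suc j) + T′ j) * q (suc j))
    ≡⟨ cong (_+_ (d * T 0 * q 0)) (trans (sumTo-cong n (λ j → *-distribʳ-+ (q (suc j)) (d * T (suc j)) (T′ j)))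
                                       (sumTo-+ n _ _)) ⟩
  d * T 0 * q 0 + (sumTo n (λ j → d * T (suc j) * q (suc j)) + Σ′)
    ≡⟨ sym (+-assoc (d * T 0 * q 0) _ Σ′) ⟩
  d * T 0 * q 0 + sumTo n (λ j → d * T (suc j) * q (suc j)) + Σ′
    ≡⟨ cong (_+ Σ′) factor-d ⟩
  d * sumTo n (λ j → T j * q j) + Σ′ ∎
  where
  T = rStirling d n
  T′ = rStirling (d + 1ℤ) n
  Σ′ = sumTo n (λ j → T′ j * q (suc j))
  factor-d : d * T 0 * q 0 + sumTo n (λ j → d * T (suc j) * q (suc j)) ≡ d * sumTo n (λ j → T j * q j)
  factor-d = begin
    d * T 0 * q 0 + sumTo n (λ j → d * T (suc j) * q (suc j))
      ≡⟨ cong₂ _+_ (*-assoc d (T 0) (q 0))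
                   (trans (sumTo-cong n (λ j → *-assoc d (T (suc j)) (q (suc j)))) (sym (*-sumTo n d _))) ⟩
    d * (T 0 * q 0) + d * sumTo n (λ j → T (suc j) * q (suc j))
      ≡⟨ sym (*-distribˡ-+ d _ _) ⟩
    d * (T 0 * q 0 + sumTo n (λ j → T (suc j) * q (suc j)))
      ≡⟨ cong (d *_) (sym (sumTo-suc n (λ j → T j * q j))) ⟩
    d * sumTo (suc n) (λ j → T j * q j)
      ≡⟨ cong (d *_) (sumTo-vanishing-tail _ (ℕₚ.n≤1+n n)
                        (λ j n<j → trans (cong (_* q j) (rStirling-vanishing d n<j)) (*-zeroˡ (q j)))) ⟩
    d * sumTo n (λ j → T j * q j) ∎

record LinearOperator (X : Set) : Set where
  field
    apply   : (X → ℤ) → X → ℤ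
    apply-cong : ∀ {F G : X → ℤ} → (∀ y → F y ≡ G y) → ∀ x → apply F x ≡ apply G x
    apply-+ : ∀ (F G : X → ℤ) x → apply (λ y → F y + G y) x ≡ apply F x + apply G x
    apply-* : ∀ c (F : X → ℤ) x → apply (λ y → c * F y) x ≡ c * apply F x

  apply-sumTo : ∀ n (F : ℕ → X → ℤ) x → apply (λ y → sumTo n (λ j → F j y)) x ≡ sumTo n (λ j → apply (F j) x)
  apply-sumTo zero    F x = refl
  apply-sumTo (suc n) F x =
    trans (apply-+ (λ y → sumTo n (λ j → F j y)) (F (suc n)) x) (cong (_+ apply (F (suc n)) x) (apply-sumTo n F x))

-- transform n d: n elements, each joining one of d existing blocks or opening a new one through T,
-- after which that block counts as existing.
module StirlingTransform {X : Set} (T : LinearOperator X) (B : X → ℤ) where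
  open LinearOperator T

  iterate : ℕ → X → ℤ
  iterate zero    = B
  iterate (suc j) = apply (iterate j)

  transform : ℕ → ℤ → X → ℤ
  transform zero    d x = B x
  transform (suc n) d x = d * transform n d x + apply (transform n (d + 1ℤ)) x

  transform-closed : ∀ n d x → transform n d x ≡ sumTo n (λ j → rStirling d n j * iterate j x)
  transform-closed zero    d x = sym (*-identityˡ (B x))
  transform-closed (suc n) d x = begin
    d * transform n d x + apply (transform n (d + 1ℤ)) x
      ≡⟨ cong₂ _+_ (cong (d *_) (transform-closed n d x)) (apply-cong (transform-closed n (d + 1ℤ)) x) ⟩
    d * sumTo n (λ j → rStirling d n j * iterate j x)
      + apply (λ y → sumTo n (λ j → rStirling (d + 1ℤ) n j * iterate j y)) x
      ≡⟨ cong (_+_ (d * sumTo n (λ j → rStirling d n j * iterate j x)))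
              (trans (apply-sumTo n _ x) (sumTo-cong n (λ j → apply-* (rStirling (d + 1ℤ) n j) (iterate j) x))) ⟩
    d * sumTo n (λ j → rStirling d n j * iterate j x)
      + sumTo n (λ j → rStirling (d + 1ℤ) n j * iterate (suc j) x)
      ≡⟨ sym (rStirling-sumTo-suc d n (λ j → iterate j x)) ⟩
    sumTo (suc n) (λ j → rStirling d (suc n) j * iterate j x) ∎

-- Closed forms for the stages L, M and N

binomialSum : ℕ → (ℕ → ℤ) → (ℕ → ℤ) → ℤ
binomialSum j u v = sumTo j (λ k → + (j C k) * u k * v (j ℕ.∸ k))

binomialSum-cong : ∀ j {u u′ v v′ : ℕ → ℤ} → (∀ k → u k ≡ u′ k) → (∀ r → v r ≡ v′ r) →
                   binomialSum j u v ≡ binomialSum j u′ v′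
binomialSum-cong j u≡u′ v≡v′ =
  sumTo-cong j (λ k → cong₂ (λ a b → + (j C k) * a * b) (u≡u′ k) (v≡v′ (j ℕ.∸ k)))

*-binomialSumˡ : ∀ j c (u v : ℕ → ℤ) → c * binomialSum j u v ≡ binomialSum j (λ k → c * u k) v
*-binomialSumˡ j c u v = trans (*-sumTo j c _) (sumTo-cong j (λ k → ring c (+ (j C k)) (u k) (v (j ℕ.∸ k))))
  where ring : ∀ c b a w → c * (b * a * w) ≡ b * (c * a) * w
        ring = solve-∀

*-binomialSumʳ : ∀ j c (u v : ℕ → ℤ) → c * binomialSum j u v ≡ binomialSum j u (λ r → c * v r)
*-binomialSumʳ j c u v = trans (*-sumTo j c _) (sumTo-cong j (λ k → ring c (+ (j C k)) (u k) (v (j ℕ.∸ k))))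
  where ring : ∀ c b a w → c * (b * a * w) ≡ b * a * (c * w)
        ring = solve-∀

binomialSum-suc : ∀ j (u v : ℕ → ℤ) →
  binomialSum (suc j) u v ≡ binomialSum j u (λ r → v (suc r)) + binomialSum j (λ k → u (suc k)) v
binomialSum-suc j u v = begin
  binomialSum (suc j) u v
    ≡⟨ sumTo-suc j _ ⟩
  head + sumTo j (λ k → + (suc j C suc k) * u (suc k) * v (j ℕ.∸ k))
    ≡⟨ cong (_+_ head) (trans (sumTo-cong j pascal) (sumTo-+ j _ _)) ⟩
  head + (sumTo j (λ k → + (j C suc k) * u (suc k) * v (j ℕ.∸ k)) + binomialSum j (λ k → u (suc k)) v)
    ≡⟨ sym (+-assoc head _ _) ⟩
  head + sumTo j (λ k → + (j C suc k) * u (suc k) * v (j ℕ.∸ k)) + binomialSum j (λ k → u (suc k)) v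
    ≡⟨ cong (_+ binomialSum j (λ k → u (suc k)) v) (sym (sumTo-suc j _)) ⟩
  sumTo (suc j) (λ k → + (j C k) * u k * v (suc j ℕ.∸ k)) + binomialSum j (λ k → u (suc k)) v
    ≡⟨ cong (_+ binomialSum j (λ k → u (suc k)) v) drop-last ⟩
  binomialSum j u (λ r → v (suc r)) + binomialSum j (λ k → u (suc k)) v ∎
  where
  head = 1ℤ * u 0 * v (suc j)
  pascal : ∀ k → + (suc j C suc k) * u (suc k) * v (j ℕ.∸ k)
               ≡ + (j C suc k) * u (suc k) * v (j ℕ.∸ k) + + (j C k) * u (suc k) * v (j ℕ.∸ k)
  pascal k = begin
    + (suc j C suc k) * u (suc k) * v (j ℕ.∸ k)
      ≡⟨ cong (λ c → + c * u (suc k) * v (j ℕ.∸ k)) (sym (nCk+nC[k+1]≡[n+1]C[k+1] j k)) ⟩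
    (+ (j C k) + + (j C suc k)) * u (suc k) * v (j ℕ.∸ k)
      ≡⟨ ring (+ (j C k)) (+ (j C suc k)) (u (suc k)) (v (j ℕ.∸ k)) ⟩
    + (j C suc k) * u (suc k) * v (j ℕ.∸ k) + + (j C k) * u (suc k) * v (j ℕ.∸ k) ∎
    where ring : ∀ a b x y → (a + b) * x * y ≡ b * x * y + a * x * y
          ring = solve-∀
  drop-last : sumTo (suc j) (λ k → + (j C k) * u k * v (suc j ℕ.∸ k)) ≡ binomialSum j u (λ r → v (suc r))
  drop-last = trans
    (sumTo-vanishing-tail _ (ℕₚ.n≤1+n j)
       (λ k j<k → cong (λ c → + c * u k * v (suc j ℕ.∸ k)) (k>n⇒nCk≡0 j<k)))
    (sumTo-cong-≤ j (λ k k≤j → cong (λ r → + (j C k) * u k * v r) (ℕₚ.+-∸-assoc 1 k≤j)))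

-- A new N-block takes a colour of one of e unused pairs (2e choices) or the free colour of one of
-- h pairs half-used by L or M.
newBlockN : (ℤ × ℤ → ℤ) → ℤ × ℤ → ℤ
newBlockN F (e , h) = (e + e) * F (e - 1ℤ , h) + h * F (e , h - 1ℤ)

newBlockN-linear : LinearOperator (ℤ × ℤ)
newBlockN-linear = record
  { apply      = newBlockN
  ; apply-cong = λ { F≡G (e , h) → cong₂ (λ a b → (e + e) * a + h * b) (F≡G _) (F≡G _) }
  ; apply-+    = λ { F G (e , h) → ring-+ (e + e) h (F (e - 1ℤ , h)) (G (e - 1ℤ , h)) (F (e , h - 1ℤ)) (G (e , h - 1ℤ)) }
  ; apply-*    = λ { c F (e , h) → ring-* c (e + e) h (F (e - 1ℤ , h)) (F (e , h - 1ℤ)) }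
  }
  where
  ring-+ : ∀ a h p q r s → a * (p + q) + h * (r + s) ≡ a * p + h * r + (a * q + h * s)
  ring-+ = solve-∀
  ring-* : ∀ c a h p r → a * (c * p) + h * (c * r) ≡ c * (a * p + h * r)
  ring-* = solve-∀

open StirlingTransform newBlockN-linear (const 1ℤ)
  renaming (iterate to blocksN; transform to waysN; transform-closed to waysN-closed)

blocksN-closed : ∀ j e h → blocksN j (e , h) ≡ binomialSum j (falling h) (falling2 (e + e))
blocksN-closed zero    e h = refl
blocksN-closed (suc j) e h = begin
  (e + e) * blocksN j (e - 1ℤ , h) + h * blocksN j (e , h - 1ℤ)
    ≡⟨ cong₂ (λ a b → (e + e) * a + h * b) (blocksN-closed j (e - 1ℤ) h) (blocksN-closed j e (h - 1ℤ)) ⟩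
  (e + e) * binomialSum j (falling h) (falling2 (e - 1ℤ + (e - 1ℤ)))
    + h * binomialSum j (falling (h - 1ℤ)) (falling2 (e + e))
    ≡⟨ cong₂ _+_ (*-binomialSumʳ j (e + e) (falling h) (falling2 (e - 1ℤ + (e - 1ℤ))))
                 (*-binomialSumˡ j h (falling (h - 1ℤ)) (falling2 (e + e))) ⟩
  binomialSum j (falling h) (λ r → (e + e) * falling2 (e - 1ℤ + (e - 1ℤ)) r)
    + binomialSum j (λ k → h * falling (h - 1ℤ) k) (falling2 (e + e))
    ≡⟨ cong₂ _+_ (binomialSum-cong j (λ _ → refl) new-pair)
                 (binomialSum-cong j (λ k → sym (falling-suc h k)) (λ r → refl {x = falling2 (e + e) r})) ⟩
  binomialSum j (falling h) (λ r → falling2 (e + e) (suc r))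
    + binomialSum j (λ k → falling h (suc k)) (falling2 (e + e))
    ≡⟨ sym (binomialSum-suc j (falling h) (falling2 (e + e))) ⟩
  binomialSum (suc j) (falling h) (falling2 (e + e)) ∎
  where
  ring : ∀ e → e - 1ℤ + (e - 1ℤ) ≡ e + e - + 2
  ring = solve-∀
  new-pair : ∀ r → (e + e) * falling2 (e - 1ℤ + (e - 1ℤ)) r ≡ falling2 (e + e) (suc r)
  new-pair r = trans (cong (λ y → (e + e) * falling2 y r) (ring e)) (sym (falling2-suc (e + e) r))

-- Placing one more M-vertex after j new N-blocks (it has 2e + h - j free colours) or before them
-- gives the same count.
blocksN-M-commute : ∀ j e h →
  blocksN j (e , h) * (e + e + h - + j) ≡ (e + e) * blocksN j (e - 1ℤ , h + 1ℤ) + h * blocksN j (e , h - 1ℤ)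
blocksN-M-commute zero    e h = ring e h
  where ring : ∀ e h → 1ℤ * (e + e + h - 0ℤ) ≡ (e + e) * 1ℤ + h * 1ℤ
        ring = solve-∀
blocksN-M-commute (suc j) e h = begin
  ((e + e) * Q₁ + h * Q₂) * (e + e + h - (1ℤ + + j))
    ≡⟨ ring₁ e h (+ j) Q₁ Q₂ ⟩
  (e + e) * (Q₁ * (e - 1ℤ + (e - 1ℤ) + h - + j)) + (e + e) * Q₁ + h * (Q₂ * (e + e + (h - 1ℤ) - + j))
    ≡⟨ cong₂ (λ u w → (e + e) * u + (e + e) * Q₁ + h * w) (blocksN-M-commute j (e - 1ℤ) h)
                                                         (blocksN-M-commute j e (h - 1ℤ)) ⟩
  (e + e) * ((e - 1ℤ + (e - 1ℤ)) * Q₃ + h * Q₄) + (e + e) * Q₁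
    + h * ((e + e) * blocksN j (e - 1ℤ , h - 1ℤ + 1ℤ) + (h - 1ℤ) * Q₅)
    ≡⟨ cong (λ y → (e + e) * ((e - 1ℤ + (e - 1ℤ)) * Q₃ + h * Q₄) + (e + e) * Q₁
                   + h * ((e + e) * blocksN j (e - 1ℤ , y) + (h - 1ℤ) * Q₅)) (ring₂ h) ⟩
  (e + e) * ((e - 1ℤ + (e - 1ℤ)) * Q₃ + h * Q₄) + (e + e) * Q₁ + h * ((e + e) * Q₁ + (h - 1ℤ) * Q₅)
    ≡⟨ ring₃ e h Q₁ Q₃ Q₄ Q₅ ⟩
  (e + e) * ((e - 1ℤ + (e - 1ℤ)) * Q₃ + (h + 1ℤ) * Q₁) + h * ((e + e) * Q₄ + (h - 1ℤ) * Q₅)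
    ≡⟨ cong (λ y → (e + e) * ((e - 1ℤ + (e - 1ℤ)) * Q₃ + (h + 1ℤ) * blocksN j (e - 1ℤ , y))
                   + h * ((e + e) * Q₄ + (h - 1ℤ) * Q₅)) (sym (ring₄ h)) ⟩
  (e + e) * ((e - 1ℤ + (e - 1ℤ)) * Q₃ + (h + 1ℤ) * blocksN j (e - 1ℤ , h + 1ℤ - 1ℤ))
    + h * ((e + e) * Q₄ + (h - 1ℤ) * Q₅) ∎
  where
  Q₁ = blocksN j (e - 1ℤ , h)
  Q₂ = blocksN j (e , h - 1ℤ)
  Q₃ = blocksN j (e - 1ℤ - 1ℤ , h + 1ℤ)
  Q₄ = blocksN j (e - 1ℤ , h - 1ℤ)
  Q₅ = blocksN j (e , h - 1ℤ - 1ℤ)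
  ring₁ : ∀ e h p Q₁ Q₂ → ((e + e) * Q₁ + h * Q₂) * (e + e + h - (1ℤ + p))
          ≡ (e + e) * (Q₁ * (e - 1ℤ + (e - 1ℤ) + h - p)) + (e + e) * Q₁ + h * (Q₂ * (e + e + (h - 1ℤ) - p))
  ring₁ = solve-∀
  ring₂ : ∀ h → h - 1ℤ + 1ℤ ≡ h
  ring₂ = solve-∀
  ring₃ : ∀ e h Q₁ Q₃ Q₄ Q₅ →
          (e + e) * ((e - 1ℤ + (e - 1ℤ)) * Q₃ + h * Q₄) + (e + e) * Q₁ + h * ((e + e) * Q₁ + (h - 1ℤ) * Q₅)
          ≡ (e + e) * ((e - 1ℤ + (e - 1ℤ)) * Q₃ + (h + 1ℤ) * Q₁) + h * ((e + e) * Q₄ + (h - 1ℤ) * Q₅)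
  ring₃ = solve-∀
  ring₄ : ∀ h → h + 1ℤ - 1ℤ ≡ h
  ring₄ = solve-∀

-- Colour m M-vertices, then n N-vertices, starting from e unused pairs and h pairs half-used by L or M.
waysMN : ℕ → ℕ → ℤ → ℤ → ℤ
waysMN zero    n e h = waysN n 0ℤ (e , h)
waysMN (suc m) n e h = (e + e) * waysMN m n (e - 1ℤ) (h + 1ℤ) + h * waysMN m n e (h - 1ℤ)

blocksN-falling-suc : ∀ j m e h →
  (e + e) * (blocksN j (e - 1ℤ , h + 1ℤ) * falling (e - 1ℤ + (e - 1ℤ) + (h + 1ℤ) - + j) m)
    + h * (blocksN j (e , h - 1ℤ) * falling (e + e + (h - 1ℤ) - + j) m)
  ≡ blocksN j (e , h) * falling (e + e + h - + j) (suc m)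
blocksN-falling-suc j m e h = begin
  (e + e) * (blocksN j (e - 1ℤ , h + 1ℤ) * falling (e - 1ℤ + (e - 1ℤ) + (h + 1ℤ) - + j) m)
    + h * (blocksN j (e , h - 1ℤ) * falling (e + e + (h - 1ℤ) - + j) m)
    ≡⟨ cong₂ (λ u w → (e + e) * (blocksN j (e - 1ℤ , h + 1ℤ) * falling u m) + h * (blocksN j (e , h - 1ℤ) * falling w m))
             (ring₁ e h (+ j)) (ring₂ e h (+ j)) ⟩
  (e + e) * (blocksN j (e - 1ℤ , h + 1ℤ) * F) + h * (blocksN j (e , h - 1ℤ) * F)
    ≡⟨ ring₃ (e + e) h (blocksN j (e - 1ℤ , h + 1ℤ)) (blocksN j (e , h - 1ℤ)) F ⟩
  ((e + e) * blocksN j (e - 1ℤ , h + 1ℤ) + h * blocksN j (e , h - 1ℤ)) * F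
    ≡⟨ cong (_* F) (sym (blocksN-M-commute j e h)) ⟩
  blocksN j (e , h) * x * F
    ≡⟨ trans (*-assoc (blocksN j (e , h)) x F) (cong (blocksN j (e , h) *_) (sym (falling-suc x m))) ⟩
  blocksN j (e , h) * falling x (suc m) ∎
  where
  x = e + e + h - + j
  F = falling (x - 1ℤ) m
  ring₁ : ∀ e h p → e - 1ℤ + (e - 1ℤ) + (h + 1ℤ) - p ≡ e + e + h - p - 1ℤ
  ring₁ = solve-∀
  ring₂ : ∀ e h p → e + e + (h - 1ℤ) - p ≡ e + e + h - p - 1ℤ
  ring₂ = solve-∀
  ring₃ : ∀ a h q₁ q₂ f → a * (q₁ * f) + h * (q₂ * f) ≡ (a * q₁ + h * q₂) * f
  ring₃ = solve-∀

waysMN-closed : ∀ m n e h →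
  waysMN m n e h ≡ sumTo n (λ j → + S n j * (blocksN j (e , h) * falling (e + e + h - + j) m))
waysMN-closed zero    n e h = trans (waysN-closed n 0ℤ (e , h))
  (sumTo-cong n (λ j → cong₂ _*_ (rStirling-0≡S n j) (sym (*-identityʳ _))))
waysMN-closed (suc m) n e h = begin
  (e + e) * waysMN m n (e - 1ℤ) (h + 1ℤ) + h * waysMN m n e (h - 1ℤ)
    ≡⟨ cong₂ (λ a b → (e + e) * a + h * b) (waysMN-closed m n (e - 1ℤ) (h + 1ℤ)) (waysMN-closed m n e (h - 1ℤ)) ⟩
  (e + e) * sumTo n (λ j → + S n j * T₁ j) + h * sumTo n (λ j → + S n j * T₂ j)
    ≡⟨ trans (cong₂ _+_ (*-sumTo n (e + e) _) (*-sumTo n h _)) (sym (sumTo-+ n _ _)) ⟩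
  sumTo n (λ j → (e + e) * (+ S n j * T₁ j) + h * (+ S n j * T₂ j))
    ≡⟨ sumTo-cong n (λ j → trans (ring (e + e) h (+ S n j) (T₁ j) (T₂ j))
                                 (cong (+ S n j *_) (blocksN-falling-suc j m e h))) ⟩
  sumTo n (λ j → + S n j * (blocksN j (e , h) * falling (e + e + h - + j) (suc m))) ∎
  where
  T₁ T₂ : ℕ → ℤ
  T₁ j = blocksN j (e - 1ℤ , h + 1ℤ) * falling (e - 1ℤ + (e - 1ℤ) + (h + 1ℤ) - + j) m
  T₂ j = blocksN j (e , h - 1ℤ) * falling (e + e + (h - 1ℤ) - + j) m
  ring : ∀ a h s t₁ t₂ → a * (s * t₁) + h * (s * t₂) ≡ s * (a * t₁ + h * t₂)
  ring = solve-∀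

-- A new L-block takes a colour of one of e unused pairs; a counts the pairs half-used by L.
newBlockL : (ℤ × ℤ → ℤ) → ℤ × ℤ → ℤ
newBlockL F (e , a) = (e + e) * F (e - 1ℤ , a + 1ℤ)

newBlockL-linear : LinearOperator (ℤ × ℤ)
newBlockL-linear = record
  { apply      = newBlockL
  ; apply-cong = λ { F≡G (e , a) → cong ((e + e) *_) (F≡G _) }
  ; apply-+    = λ { F G (e , a) → *-distribˡ-+ (e + e) _ _ }
  ; apply-*    = λ { c F (e , a) → ring c (e + e) (F (e - 1ℤ , a + 1ℤ)) }
  }
  where
  ring : ∀ c a p → a * (c * p) ≡ c * (a * p)
  ring = solve-∀

waysMN-pair : ℕ → ℕ → ℤ × ℤ → ℤ
waysMN-pair m n (e , a) = waysMN m n e a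

module StageL (m n : ℕ) = StirlingTransform newBlockL-linear (waysMN-pair m n)

waysL : ℕ → ℕ → ℕ → ℤ → ℤ × ℤ → ℤ
waysL = StageL.transform

blocksL-closed : ∀ m n i e a → StageL.iterate m n i (e , a) ≡ falling2 (e + e) i * waysMN m n (e - + i) (a + + i)
blocksL-closed m n zero    e a = sym (trans (*-identityˡ _) (cong₂ (waysMN m n) (+-identityʳ e) (+-identityʳ a)))
blocksL-closed m n (suc i) e a = begin
  (e + e) * StageL.iterate m n i (e - 1ℤ , a + 1ℤ)
    ≡⟨ cong ((e + e) *_) (blocksL-closed m n i (e - 1ℤ) (a + 1ℤ)) ⟩
  (e + e) * (falling2 (e - 1ℤ + (e - 1ℤ)) i * waysMN m n (e - 1ℤ - + i) (a + 1ℤ + + i))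
    ≡⟨ cong₂ (λ u w → (e + e) * (falling2 u i * w))
             (ring₁ e) (cong₂ (waysMN m n) (ring₂ e (+ i)) (+-assoc a 1ℤ (+ i))) ⟩
  (e + e) * (falling2 (e + e - + 2) i * waysMN m n (e - + suc i) (a + + suc i))
    ≡⟨ sym (*-assoc (e + e) _ _) ⟩
  (e + e) * falling2 (e + e - + 2) i * waysMN m n (e - + suc i) (a + + suc i)
    ≡⟨ cong (_* waysMN m n (e - + suc i) (a + + suc i)) (sym (falling2-suc (e + e) i)) ⟩
  falling2 (e + e) (suc i) * waysMN m n (e - + suc i) (a + + suc i) ∎
  where
  ring₁ : ∀ e → e - 1ℤ + (e - 1ℤ) ≡ e + e - + 2
  ring₁ = solve-∀
  ring₂ : ∀ e p → e - 1ℤ - p ≡ e - (1ℤ + p)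
  ring₂ = solve-∀

-- k counts the N-blocks placed on the free colour of a pair half-used by one of the i L-blocks.
blocksN-after-L : ∀ e i j →
  falling2 (e + e) i * blocksN j (e - + i , + i)
    ≡ sumTo (i ℕ.⊓ j) (λ k → + (k ! ℕ.* (i C k) ℕ.* (j C k)) * falling2 (e + e) (i ℕ.+ j ℕ.∸ k))
blocksN-after-L e i j = begin
  falling2 (e + e) i * blocksN j (e - + i , + i)
    ≡⟨ cong (falling2 (e + e) i *_) (blocksN-closed j (e - + i) (+ i)) ⟩
  falling2 (e + e) i * binomialSum j (falling (+ i)) (falling2 (e - + i + (e - + i)))
    ≡⟨ *-binomialSumʳ j (falling2 (e + e) i) (falling (+ i)) (falling2 (e - + i + (e - + i))) ⟩
  binomialSum j (falling (+ i)) (λ r → falling2 (e + e) i * falling2 (e - + i + (e - + i)) r)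
    ≡⟨ binomialSum-cong j (falling-ℕ i) after-L ⟩
  binomialSum j (λ k → + (k ! ℕ.* (i C k))) (λ r → falling2 (e + e) (i ℕ.+ r))
    ≡⟨ sumTo-cong-≤ j term ⟩
  sumTo j g
    ≡⟨ sumTo-vanishing-tail g (ℕₚ.m⊓n≤n i j) vanish ⟩
  sumTo (i ℕ.⊓ j) g ∎
  where
  g : ℕ → ℤ
  g k = + (k ! ℕ.* (i C k) ℕ.* (j C k)) * falling2 (e + e) (i ℕ.+ j ℕ.∸ k)
  ring : ∀ e i → e - i + (e - i) ≡ e + e - (i + i)
  ring = solve-∀
  after-L : ∀ r → falling2 (e + e) i * falling2 (e - + i + (e - + i)) r ≡ falling2 (e + e) (i ℕ.+ r)
  after-L r = begin
    falling2 (e + e) i * falling2 (e - + i + (e - + i)) r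
      ≡⟨ cong (λ y → falling2 (e + e) i * falling2 y r) (ring e (+ i)) ⟩
    falling2 (e + e) i * falling2 (e + e - + (i ℕ.+ i)) r
      ≡⟨ cong (λ k → falling2 (e + e) i * falling2 (e + e - + k) r) (cong (i ℕ.+_) (sym (ℕₚ.+-identityʳ i))) ⟩
    falling2 (e + e) i * falling2 (e + e - + (2 ℕ.* i)) r
      ≡⟨ falling2-+ (e + e) i r ⟩
    falling2 (e + e) (i ℕ.+ r) ∎
  term : ∀ k → k ℕ.≤ j →
    + (j C k) * + (k ! ℕ.* (i C k)) * falling2 (e + e) (i ℕ.+ (j ℕ.∸ k)) ≡ g k
  term k k≤j = cong₂ _*_
    (trans (sym (pos-* (j C k) (k ! ℕ.* (i C k)))) (cong +_ (ℕₚ.*-comm (j C k) (k ! ℕ.* (i C k)))))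
    (cong (falling2 (e + e)) (sym (ℕₚ.+-∸-assoc i k≤j)))
  vanish : ∀ k → i ℕ.⊓ j ℕ.< k → g k ≡ 0ℤ
  vanish k i⊓j<k with k ℕ.≤? i
  ... | no k≰i rewrite k>n⇒nCk≡0 (ℕₚ.≰⇒> k≰i) | ℕₚ.*-zeroʳ (k !) = refl
  ... | yes k≤i rewrite k>n⇒nCk≡0 (ℕₚ.≰⇒> (λ k≤j → ℕₚ.<⇒≱ i⊓j<k (ℕₚ.⊓-glb k≤i k≤j)))
                      | ℕₚ.*-zeroʳ (k ! ℕ.* (i C k)) = refl

H₁-term : ℕ → ℕ → ℕ → ℤ → ℕ → ℕ → ℕ → ℤ
H₁-term l m n x i j k =
  + ((k !) ℕ.* (i C k) ℕ.* (j C k) ℕ.* S l i ℕ.* S n j) * falling2 x (i ℕ.+ j ℕ.∸ k) * falling (x - + (i ℕ.+ j)) m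

H₁-summand : ∀ l m n e i j →
  + S l i * (falling2 (e + e) i * (+ S n j * (blocksN j (e - + i , + i) * falling (e - + i + (e - + i) + + i - + j) m)))
    ≡ sumTo (i ℕ.⊓ j) (H₁-term l m n (e + e) i j)
H₁-summand l m n e i j = begin
  + S l i * (falling2 x i * (+ S n j * (B * falling (e - + i + (e - + i) + + i - + j) m)))
    ≡⟨ ring₁ (+ S l i) (falling2 x i) (+ S n j) B _ ⟩
  + S l i * + S n j * falling (e - + i + (e - + i) + + i - + j) m * (falling2 x i * B)
    ≡⟨ cong₂ (λ y z → + S l i * + S n j * falling y m * z) (ring₂ e (+ i) (+ j)) (blocksN-after-L e i j) ⟩
  + S l i * + S n j * G * sumTo (i ℕ.⊓ j) (λ k → + c k * falling2 x (i ℕ.+ j ℕ.∸ k))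
    ≡⟨ *-sumTo (i ℕ.⊓ j) (+ S l i * + S n j * G) _ ⟩
  sumTo (i ℕ.⊓ j) (λ k → + S l i * + S n j * G * (+ c k * falling2 x (i ℕ.+ j ℕ.∸ k)))
    ≡⟨ sumTo-cong (i ℕ.⊓ j) (λ k → trans (ring₃ (+ S l i) (+ S n j) G (+ c k) (falling2 x (i ℕ.+ j ℕ.∸ k)))
                                        (cong (λ a → a * falling2 x (i ℕ.+ j ℕ.∸ k) * G) (coefficient k))) ⟩
  sumTo (i ℕ.⊓ j) (H₁-term l m n x i j) ∎
  where
  x = e + e
  B = blocksN j (e - + i , + i)
  G = falling (x - + (i ℕ.+ j)) m
  c : ℕ → ℕ
  c k = k ! ℕ.* (i C k) ℕ.* (j C k)
  coefficient : ∀ k → + c k * + S l i * + S n j ≡ + (c k ℕ.* S l i ℕ.* S n j)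
  coefficient k = trans (cong (_* + S n j) (sym (pos-* (c k) (S l i)))) (sym (pos-* (c k ℕ.* S l i) (S n j)))
  ring₁ : ∀ a f s q F → a * (f * (s * (q * F))) ≡ a * s * F * (f * q)
  ring₁ = solve-∀
  ring₂ : ∀ e i j → e - i + (e - i) + i - j ≡ e + e - (i + j)
  ring₂ = solve-∀
  ring₃ : ∀ a b G c f → a * b * G * (c * f) ≡ c * a * b * f * G
  ring₃ = solve-∀

waysL-H₁ : ∀ l m n e → waysL m n l 0ℤ (e , 0ℤ) ≡ H₁ℕ l m n (e + e)
waysL-H₁ l m n e = begin
  waysL m n l 0ℤ (e , 0ℤ)
    ≡⟨ StageL.transform-closed m n l 0ℤ (e , 0ℤ) ⟩
  sumTo l (λ i → rStirling 0ℤ l i * StageL.iterate m n i (e , 0ℤ))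
    ≡⟨ sumTo-cong l summand ⟩
  sumTo l (λ i → sumTo n (λ j → sumTo (i ℕ.⊓ j) (H₁-term l m n (e + e) i j))) ∎
  where
  summand : ∀ i → rStirling 0ℤ l i * StageL.iterate m n i (e , 0ℤ)
                  ≡ sumTo n (λ j → sumTo (i ℕ.⊓ j) (H₁-term l m n (e + e) i j))
  summand i = begin
    rStirling 0ℤ l i * StageL.iterate m n i (e , 0ℤ)
      ≡⟨ cong₂ _*_ (rStirling-0≡S l i) (trans (blocksL-closed m n i e 0ℤ)
                                             (cong (falling2 (e + e) i *_) (waysMN-closed m n (e - + i) (+ i)))) ⟩
    + S l i * (falling2 (e + e) i * sumTo n (λ j → + S n j * T j))
      ≡⟨ trans (cong (+ S l i *_) (*-sumTo n (falling2 (e + e) i) _)) (*-sumTo n (+ S l i) _) ⟩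
    sumTo n (λ j → + S l i * (falling2 (e + e) i * (+ S n j * T j)))
      ≡⟨ sumTo-cong n (H₁-summand l m n e i) ⟩
    sumTo n (λ j → sumTo (i ℕ.⊓ j) (H₁-term l m n (e + e) i j)) ∎
    where
    T : ℕ → ℤ
    T j = blocksN j (e - + i , + i) * falling (e - + i + (e - + i) + + i - + j) m

-- Colour pairs and the recursion ways

-- The cliques -K_l, +K_m and -K_n of the join.
data Part : Set where
  pL pM pN : Part

edgeLabel : Part → Part → EdgeLabel
edgeLabel pL pL = neg
edgeLabel pN pN = neg
edgeLabel _  _  = pos

okSame okOpposite : EdgeLabel → Bool
okSame none = true
okSame pos  = false
okSame neg  = true
okOpposite none = true
okOpposite pos  = true
okOpposite neg  = false

edgeLabel-comm : ∀ p q → edgeLabel p q ≡ edgeLabel q p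
edgeLabel-comm pL pL = refl
edgeLabel-comm pL pM = refl
edgeLabel-comm pL pN = refl
edgeLabel-comm pM pL = refl
edgeLabel-comm pM pM = refl
edgeLabel-comm pM pN = refl
edgeLabel-comm pN pL = refl
edgeLabel-comm pN pM = refl
edgeLabel-comm pN pN = refl

okSame-edgeLabel⇒≡ : ∀ p q → okSame (edgeLabel p q) ≡ true → p ≡ q
okSame-edgeLabel⇒≡ pL pL _ = refl
okSame-edgeLabel⇒≡ pL pM ()
okSame-edgeLabel⇒≡ pL pN ()
okSame-edgeLabel⇒≡ pM pL ()
okSame-edgeLabel⇒≡ pM pM ()
okSame-edgeLabel⇒≡ pM pN ()
okSame-edgeLabel⇒≡ pN pL ()
okSame-edgeLabel⇒≡ pN pM ()
okSame-edgeLabel⇒≡ pN pN _ = refl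

okSame∧okOpposite-edgeLabel : ∀ p q → okSame (edgeLabel p q) ∧ okOpposite (edgeLabel p q) ≡ false
okSame∧okOpposite-edgeLabel pL pL = refl
okSame∧okOpposite-edgeLabel pL pM = refl
okSame∧okOpposite-edgeLabel pL pN = refl
okSame∧okOpposite-edgeLabel pM pL = refl
okSame∧okOpposite-edgeLabel pM pM = refl
okSame∧okOpposite-edgeLabel pM pN = refl
okSame∧okOpposite-edgeLabel pN pL = refl
okSame∧okOpposite-edgeLabel pN pM = refl
okSame∧okOpposite-edgeLabel pN pN = refl

-- The part whose vertices use a given colour, if any.
Slot : Set
Slot = Maybe Part

fits avoids : Part → Slot → Bool
fits   τ nothing  = true
fits   τ (just p) = okSame (edgeLabel p τ)
avoids τ nothing  = true
avoids τ (just p) = okOpposite (edgeLabel p τ)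

allowed : Part → Slot × Slot → Bool
allowed τ (s , o) = fits τ s ∧ avoids τ o

-- The unordered content of a colour pair ±a. The unreachable L/L and N/N are counted as blocked,
-- which (like M/M) admits no further vertex.
data Occupancy : Set where
  unused  : Occupancy
  half    : Part → Occupancy
  LM LN MN : Occupancy
  blocked : Occupancy

bothUsed : Part → Part → Occupancy
bothUsed pL pM = LM
bothUsed pM pL = LM
bothUsed pL pN = LN
bothUsed pN pL = LN
bothUsed pM pN = MN
bothUsed pN pM = MN
bothUsed _  _  = blocked

occupancy : Slot × Slot → Occupancy
occupancy (nothing , nothing) = unused
occupancy (nothing , just p)  = half p
occupancy (just p  , nothing) = half p
occupancy (just p  , just q)  = bothUsed p q

-- place reads the choices off one pair of the given occupancy; placeAt-occupancy shows the choice
-- of pair is irrelevant.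
representative : Occupancy → Slot × Slot
representative unused   = nothing , nothing
representative (half p) = just p , nothing
representative LM       = just pL , just pM
representative LN       = just pL , just pN
representative MN       = just pM , just pN
representative blocked  = just pM , just pM

index : Occupancy → ℕ
index unused    = 0
index (half pL) = 1
index (half pM) = 2
index (half pN) = 3
index LM        = 4
index LN        = 5
index MN        = 6
index blocked   = 7

_==_ : Occupancy → Occupancy → Bool
k == k′ = index k ℕ.≡ᵇ index k′

move : (Occupancy → ℤ) → Occupancy → Occupancy → Occupancy → ℤ
move v k k′ x = if x == k then (if x == k′ then v x else v x - 1ℤ)
                          else (if x == k′ then v x + 1ℤ else v x)

sumOcc : (Occupancy → ℤ) → ℤ
sumOcc g = g unused + g (half pL) + g (half pM) + g (half pN) + g LM + g LN + g MN + g blocked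

-- A τ-vertex takes +a or -a, where (s , o) is the content of (+a , -a).
placeAt : Part → Slot × Slot → ((Occupancy → ℤ) → ℤ) → (Occupancy → ℤ) → ℤ
placeAt τ (s , o) F v =
  (if allowed τ (s , o) then F (move v (occupancy (s , o)) (occupancy (just τ , o))) else 0ℤ)
  + (if allowed τ (o , s) then F (move v (occupancy (s , o)) (occupancy (s , just τ))) else 0ℤ)

place : Part → Occupancy → ((Occupancy → ℤ) → ℤ) → (Occupancy → ℤ) → ℤ
place τ k = placeAt τ (representative k)

extend : Part → ((Occupancy → ℤ) → ℤ) → (Occupancy → ℤ) → ℤ
extend τ F v = sumOcc (λ k → v k * place τ k F v)

-- ways τs v z counts the colourings of further vertices of parts τs, all joined to each other and to
-- the earlier vertices, when v gives the number of pairs of each occupancy and z says whether 0 is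
-- still free.
ways : List Part → (Occupancy → ℤ) → Bool → ℤ
ways []       v z = 1ℤ
ways (τ ∷ τs) v z = extend τ (λ w → ways τs w z) v + (if z then ways τs v false else 0ℤ)

sumOcc-cong : ∀ {f g : Occupancy → ℤ} → (∀ k → f k ≡ g k) → sumOcc f ≡ sumOcc g
sumOcc-cong f≗g = cong₂ _+_ (cong₂ _+_ (cong₂ _+_ (cong₂ _+_ (cong₂ _+_ (cong₂ _+_ (cong₂ _+_
  (f≗g unused) (f≗g (half pL))) (f≗g (half pM))) (f≗g (half pN))) (f≗g LM)) (f≗g LN)) (f≗g MN)) (f≗g blocked)

move-cong : ∀ {v w : Occupancy → ℤ} → (∀ k → v k ≡ w k) → ∀ k k′ x → move v k k′ x ≡ move w k k′ x
move-cong v≗w k k′ x rewrite v≗w x = refl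

move-self : ∀ v k x → move v k k x ≡ v x
move-self v k x with x == k
... | true  = refl
... | false = refl

Respects : ((Occupancy → ℤ) → ℤ) → Set
Respects F = ∀ {v w} → (∀ k → v k ≡ w k) → F v ≡ F w

placeAt-cong : ∀ τ p {F} → Respects F → Respects (placeAt τ p F)
placeAt-cong τ (s , o) F-resp v≗w = cong₂ _+_
  (cong (λ y → if allowed τ (s , o) then y else 0ℤ) (F-resp (move-cong v≗w _ _)))
  (cong (λ y → if allowed τ (o , s) then y else 0ℤ) (F-resp (move-cong v≗w _ _)))

ways-cong : ∀ τs z → Respects (λ v → ways τs v z)
ways-cong []       z v≗w = refl
ways-cong (τ ∷ τs) z v≗w = cong₂ _+_
  (sumOcc-cong (λ k → cong₂ _*_ (v≗w k) (placeAt-cong τ (representative k) (ways-cong τs z) v≗w)))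
  (cong (λ y → if z then y else 0ℤ) (ways-cong τs false v≗w))

usedByN halfByLM : (Occupancy → ℤ) → ℤ
usedByN  v = v (half pN) + v LN + v MN
halfByLM v = v (half pL) + v (half pM)

place-N : ∀ v {G : (Occupancy → ℤ) → ℤ} → Respects G → ∀ {X₁ X₂} →
  G (move v unused (half pN)) ≡ X₁ → G (move v (half pL) LN) ≡ X₂ → G (move v (half pM) MN) ≡ X₂ →
  extend pN G v ≡ usedByN v * G v + ((v unused + v unused) * X₁ + halfByLM v * X₂)
place-N v {G} G-resp {X₁} {X₂} eq₁ eq₂ eq₃
  rewrite eq₁ | eq₂ | eq₃
        | G-resp (move-self v (half pN)) | G-resp (move-self v LN) | G-resp (move-self v MN)
  = ring (v unused) (v (half pL)) (v (half pM)) (v (half pN)) (v LM) (v LN) (v MN) (v blocked) (G v) X₁ X₂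
  where
  ring : ∀ a b c d e f g h X₀ X₁ X₂ →
         a * (X₁ + X₁) + b * (0ℤ + X₂) + c * (0ℤ + X₂) + d * (X₀ + 0ℤ) + e * (0ℤ + 0ℤ)
         + f * (0ℤ + X₀) + g * (0ℤ + X₀) + h * (0ℤ + 0ℤ)
         ≡ (d + f + g) * X₀ + ((a + a) * X₁ + (b + c) * X₂)
  ring = solve-∀

ways-N : ∀ n v → ways (replicate n pN) v false ≡ waysN n (usedByN v) (v unused , halfByLM v)
ways-N zero    v = refl
ways-N (suc n) v = begin
  extend pN G v + 0ℤ
    ≡⟨ +-identityʳ _ ⟩
  extend pN G v
    ≡⟨ place-N v (ways-cong (replicate n pN) false)
         (trans (ways-N n _) (cong (λ d → waysN n d (e - 1ℤ , h)) (ring₁ (v (half pN)) (v LN) (v MN))))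
         (trans (ways-N n _) (cong₂ (λ d h → waysN n d (e , h))
                                    (ring₂ (v (half pN)) (v LN) (v MN)) (ring₃ (v (half pL)) (v (half pM)))))
         (trans (ways-N n _) (cong₂ (λ d h → waysN n d (e , h))
                                    (ring₄ (v (half pN)) (v LN) (v MN)) (ring₅ (v (half pL)) (v (half pM))))) ⟩
  d * G v + ((e + e) * waysN n (d + 1ℤ) (e - 1ℤ , h) + h * waysN n (d + 1ℤ) (e , h - 1ℤ))
    ≡⟨ cong (λ x → d * x + ((e + e) * waysN n (d + 1ℤ) (e - 1ℤ , h) + h * waysN n (d + 1ℤ) (e , h - 1ℤ)))
            (ways-N n v) ⟩
  waysN (suc n) d (e , h) ∎
  where
  G = λ w → ways (replicate n pN) w false
  d = usedByN v
  e = v unused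
  h = halfByLM v
  ring₁ : ∀ a b c → a + 1ℤ + b + c ≡ a + b + c + 1ℤ
  ring₁ = solve-∀
  ring₂ : ∀ a b c → a + (b + 1ℤ) + c ≡ a + b + c + 1ℤ
  ring₂ = solve-∀
  ring₃ : ∀ a b → a - 1ℤ + b ≡ a + b - 1ℤ
  ring₃ = solve-∀
  ring₄ : ∀ a b c → a + b + (c + 1ℤ) ≡ a + b + c + 1ℤ
  ring₄ = solve-∀
  ring₅ : ∀ a b → a + (b - 1ℤ) ≡ a + b - 1ℤ
  ring₅ = solve-∀

place-M : ∀ v {G : (Occupancy → ℤ) → ℤ} {X₁ X₂} → v (half pN) ≡ 0ℤ →
  G (move v unused (half pM)) ≡ X₁ → G (move v (half pL) LM) ≡ X₂ → G (move v (half pM) blocked) ≡ X₂ →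
  extend pM G v ≡ (v unused + v unused) * X₁ + halfByLM v * X₂
place-M v {G} {X₁} {X₂} no-N eq₁ eq₂ eq₃ rewrite no-N | eq₁ | eq₂ | eq₃ =
  ring (v unused) (v (half pL)) (v (half pM)) (v LM) (v LN) (v MN) (v blocked) X₁ X₂ (G (move v (half pN) MN))
  where
  ring : ∀ a b c e f g h X₁ X₂ Y →
         a * (X₁ + X₁) + b * (0ℤ + X₂) + c * (0ℤ + X₂) + 0ℤ * (0ℤ + Y) + e * (0ℤ + 0ℤ)
         + f * (0ℤ + 0ℤ) + g * (0ℤ + 0ℤ) + h * (0ℤ + 0ℤ)
         ≡ (a + a) * X₁ + (b + c) * X₂
  ring = solve-∀

ways-MN : ∀ m n v → v (half pN) ≡ 0ℤ → v LN ≡ 0ℤ → v MN ≡ 0ℤ →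
  ways (replicate m pM ++ replicate n pN) v false ≡ waysMN m n (v unused) (halfByLM v)
ways-MN zero    n v no-hN no-LN no-MN = trans (ways-N n v) (cong (λ d → waysN n d (v unused , halfByLM v)) no-N)
  where no-N : usedByN v ≡ 0ℤ
        no-N rewrite no-hN | no-LN | no-MN = refl
ways-MN (suc m) n v no-hN no-LN no-MN = trans (+-identityʳ _)
  (place-M v {G = λ w → ways (replicate m pM ++ replicate n pN) w false}
             {X₁ = waysMN m n (e - 1ℤ) (h + 1ℤ)} {X₂ = waysMN m n e (h - 1ℤ)} no-hN
    (trans (ways-MN m n _ no-hN no-LN no-MN) (cong (waysMN m n (e - 1ℤ)) (ring₁ (v (half pL)) (v (half pM)))))
    (trans (ways-MN m n _ no-hN no-LN no-MN) (cong (waysMN m n e) (ring₂ (v (half pL)) (v (half pM)))))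
    (trans (ways-MN m n _ no-hN no-LN no-MN) (cong (waysMN m n e) (ring₃ (v (half pL)) (v (half pM))))))
  where
  e = v unused
  h = halfByLM v
  ring₁ : ∀ a b → a + (b + 1ℤ) ≡ a + b + 1ℤ
  ring₁ = solve-∀
  ring₂ : ∀ a b → a - 1ℤ + b ≡ a + b - 1ℤ
  ring₂ = solve-∀
  ring₃ : ∀ a b → a + (b - 1ℤ) ≡ a + b - 1ℤ
  ring₃ = solve-∀

place-L : ∀ v {G : (Occupancy → ℤ) → ℤ} → Respects G → ∀ {X₁} →
  v (half pM) ≡ 0ℤ → v (half pN) ≡ 0ℤ → v LM ≡ 0ℤ → v LN ≡ 0ℤ → G (move v unused (half pL)) ≡ X₁ →
  extend pL G v ≡ v (half pL) * G v + (v unused + v unused) * X₁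
place-L v {G} G-resp {X₁} no-hM no-hN no-LM no-LN eq₁
  rewrite no-hM | no-hN | no-LM | no-LN | eq₁ | G-resp (move-self v (half pL)) =
  ring (v unused) (v (half pL)) (v MN) (v blocked) (G v) X₁
       (G (move v (half pM) LM)) (G (move v (half pN) LN)) (G (move v LM LM)) (G (move v LN LN))
  where
  ring : ∀ a b f h X₀ X₁ Y₁ Y₂ Y₃ Y₄ →
         a * (X₁ + X₁) + b * (X₀ + 0ℤ) + 0ℤ * (0ℤ + Y₁) + 0ℤ * (0ℤ + Y₂) + 0ℤ * (Y₃ + 0ℤ)
         + 0ℤ * (Y₄ + 0ℤ) + f * (0ℤ + 0ℤ) + h * (0ℤ + 0ℤ)
         ≡ b * X₀ + (a + a) * X₁
  ring = solve-∀

ways-LMN : ∀ l m n v → v (half pM) ≡ 0ℤ → v (half pN) ≡ 0ℤ → v LM ≡ 0ℤ → v LN ≡ 0ℤ → v MN ≡ 0ℤ →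
  ways (replicate l pL ++ (replicate m pM ++ replicate n pN)) v false ≡ waysL m n l (v (half pL)) (v unused , v (half pL))
ways-LMN zero    m n v no-hM no-hN no-LM no-LN no-MN =
  trans (ways-MN m n v no-hN no-LN no-MN) (cong (waysMN m n (v unused)) (trans (cong (_+_ (v (half pL))) no-hM) (+-identityʳ _)))
ways-LMN (suc l) m n v no-hM no-hN no-LM no-LN no-MN = begin
  extend pL G v + 0ℤ
    ≡⟨ +-identityʳ _ ⟩
  extend pL G v
    ≡⟨ place-L v (ways-cong (replicate l pL ++ (replicate m pM ++ replicate n pN)) false) no-hM no-hN no-LM no-LN
         (ways-LMN l m n _ no-hM no-hN no-LM no-LN no-MN) ⟩
  d * G v + (e + e) * waysL m n l (d + 1ℤ) (e - 1ℤ , d + 1ℤ)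
    ≡⟨ cong (λ x → d * x + (e + e) * waysL m n l (d + 1ℤ) (e - 1ℤ , d + 1ℤ))
            (ways-LMN l m n v no-hM no-hN no-LM no-LN no-MN) ⟩
  waysL m n (suc l) d (e , d) ∎
  where
  G = λ w → ways (replicate l pL ++ (replicate m pM ++ replicate n pN)) w false
  d = v (half pL)
  e = v unused

-- The colour 0

sumOver : {A : Set} → List A → (A → ℤ) → ℤ
sumOver []       f = 0ℤ
sumOver (x ∷ xs) f = f x + sumOver xs f

sumOver-cong : {A : Set} (xs : List A) {f g : A → ℤ} → (∀ x → f x ≡ g x) → sumOver xs f ≡ sumOver xs g
sumOver-cong []       f≗g = refl
sumOver-cong (x ∷ xs) f≗g = cong₂ _+_ (f≗g x) (sumOver-cong xs f≗g)

sumOver-map : {A B : Set} (g : A → B) (xs : List A) (f : B → ℤ) → sumOver (map g xs) f ≡ sumOver xs (λ x → f (g x))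
sumOver-map g []       f = refl
sumOver-map g (x ∷ xs) f = cong (_+_ (f (g x))) (sumOver-map g xs f)

sumOver-++ : {A : Set} (xs ys : List A) (f : A → ℤ) → sumOver (xs ++ ys) f ≡ sumOver xs f + sumOver ys f
sumOver-++ []       ys f = sym (+-identityˡ _)
sumOver-++ (x ∷ xs) ys f = trans (cong (_+_ (f x)) (sumOver-++ xs ys f)) (sym (+-assoc (f x) _ _))

sumOcc-+ : ∀ (f g : Occupancy → ℤ) → sumOcc (λ k → f k + g k) ≡ sumOcc f + sumOcc g
sumOcc-+ f g = ring (f unused) (f (half pL)) (f (half pM)) (f (half pN)) (f LM) (f LN) (f MN) (f blocked)
                    (g unused) (g (half pL)) (g (half pM)) (g (half pN)) (g LM) (g LN) (g MN) (g blocked)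
  where ring : ∀ a b c d e f g h a′ b′ c′ d′ e′ f′ g′ h′ →
               a + a′ + (b + b′) + (c + c′) + (d + d′) + (e + e′) + (f + f′) + (g + g′) + (h + h′)
               ≡ a + b + c + d + e + f + g + h + (a′ + b′ + c′ + d′ + e′ + f′ + g′ + h′)
        ring = solve-∀

placeAt-+ : ∀ τ p (F G : (Occupancy → ℤ) → ℤ) v →
  placeAt τ p (λ w → F w + G w) v ≡ placeAt τ p F v + placeAt τ p G v
placeAt-+ τ (s , o) F G v with allowed τ (s , o) | allowed τ (o , s)
... | true  | true  = ring (F _) (G _) (F _) (G _)
  where ring : ∀ a b c d → a + b + (c + d) ≡ a + c + (b + d)
        ring = solve-∀
... | true  | false = ring (F _) (G _)
  where ring : ∀ a b → a + b + 0ℤ ≡ a + 0ℤ + (b + 0ℤ)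
        ring = solve-∀
... | false | true  = ring (F _) (G _)
  where ring : ∀ a b → 0ℤ + (a + b) ≡ 0ℤ + a + (0ℤ + b)
        ring = solve-∀
... | false | false = refl

placeAt-zero : ∀ τ p v → placeAt τ p (λ _ → 0ℤ) v ≡ 0ℤ
placeAt-zero τ (s , o) v with allowed τ (s , o) | allowed τ (o , s)
... | true  | true  = refl
... | true  | false = refl
... | false | true  = refl
... | false | false = refl

placeAt-congᶠ : ∀ τ p {F G : (Occupancy → ℤ) → ℤ} → (∀ w → F w ≡ G w) →
                ∀ v → placeAt τ p F v ≡ placeAt τ p G v
placeAt-congᶠ τ (s , o) F≗G v = cong₂ _+_
  (cong (λ y → if allowed τ (s , o) then y else 0ℤ) (F≗G (move v (occupancy (s , o)) (occupancy (just τ , o)))))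
  (cong (λ y → if allowed τ (o , s) then y else 0ℤ) (F≗G (move v (occupancy (s , o)) (occupancy (s , just τ)))))

extend-cong : ∀ τ {F G : (Occupancy → ℤ) → ℤ} → (∀ w → F w ≡ G w) → ∀ v → extend τ F v ≡ extend τ G v
extend-cong τ F≗G v = sumOcc-cong (λ k → cong (v k *_) (placeAt-congᶠ τ (representative k) F≗G v))

extend-+ : ∀ τ (F G : (Occupancy → ℤ) → ℤ) v → extend τ (λ w → F w + G w) v ≡ extend τ F v + extend τ G v
extend-+ τ F G v = trans
  (sumOcc-cong (λ k → trans (cong (v k *_) (placeAt-+ τ (representative k) F G v))
                            (*-distribˡ-+ (v k) (place τ k F v) (place τ k G v))))
  (sumOcc-+ (λ k → v k * place τ k F v) (λ k → v k * place τ k G v))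

extend-zero : ∀ τ v → extend τ (λ _ → 0ℤ) v ≡ 0ℤ
extend-zero τ v = sumOcc-cong (λ k → trans (cong (v k *_) (placeAt-zero τ (representative k) v)) (*-zeroʳ (v k)))

extend-sumOver : ∀ {A : Set} τ (xs : List A) (H : A → (Occupancy → ℤ) → ℤ) v →
  extend τ (λ w → sumOver xs (λ x → H x w)) v ≡ sumOver xs (λ x → extend τ (H x) v)
extend-sumOver τ []       H v = extend-zero τ v
extend-sumOver τ (x ∷ xs) H v =
  trans (extend-+ τ (H x) (λ w → sumOver xs (λ y → H y w)) v) (cong (_+_ (extend τ (H x) v)) (extend-sumOver τ xs H v))

removals : List Part → List (List Part)
removals []       = []
removals (τ ∷ τs) = τs ∷ map (τ ∷_) (removals τs)

-- With the colour 0 available, either no vertex or exactly one vertex (which is then removed) gets it.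
ways-zero : ∀ τs v → ways τs v true ≡ ways τs v false + sumOver (removals τs) (λ xs → ways xs v false)
ways-zero []       v = sym (+-identityʳ 1ℤ)
ways-zero (τ ∷ τs) v = begin
  extend τ (λ w → ways τs w true) v + ways τs v false
    ≡⟨ cong (_+ ways τs v false) (extend-cong τ (λ w → ways-zero τs w) v) ⟩
  extend τ (λ w → ways τs w false + sumOver (removals τs) (λ xs → ways xs w false)) v + ways τs v false
    ≡⟨ cong (_+ ways τs v false)
            (trans (extend-+ τ (λ w → ways τs w false) (λ w → sumOver (removals τs) (λ xs → ways xs w false)) v)
                   (cong (_+_ A) (extend-sumOver τ (removals τs) (λ xs w → ways xs w false) v))) ⟩
  A + sumOver (removals τs) (λ xs → extend τ (λ w → ways xs w false) v) + ways τs v false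
    ≡⟨ cong (λ y → A + y + ways τs v false) moved ⟩
  A + sumOver (map (τ ∷_) (removals τs)) (λ xs → ways xs v false) + ways τs v false
    ≡⟨ ring A _ _ ⟩
  (A + 0ℤ) + (ways τs v false + sumOver (map (τ ∷_) (removals τs)) (λ xs → ways xs v false)) ∎
  where
  A = extend τ (λ w → ways τs w false) v
  moved : sumOver (removals τs) (λ xs → extend τ (λ w → ways xs w false) v)
          ≡ sumOver (map (τ ∷_) (removals τs)) (λ xs → ways xs v false)
  moved = trans (sumOver-cong (removals τs) (λ xs → sym (+-identityʳ _)))
                (sym (sumOver-map (τ ∷_) (removals τs) (λ xs → ways xs v false)))
  ring : ∀ a b c → a + b + c ≡ (a + 0ℤ) + (c + b)
  ring = solve-∀

removals-replicate : ∀ (H : List Part → ℤ) τ l ys →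
  sumOver (removals (replicate l τ ++ ys)) H
    ≡ + l * H (replicate (ℕ.pred l) τ ++ ys) + sumOver (removals ys) (λ xs → H (replicate l τ ++ xs))
removals-replicate H τ zero    ys = sym (trans (cong (_+ sumOver (removals ys) H) (*-zeroˡ (H ys))) (+-identityˡ _))
removals-replicate H τ (suc l) ys = begin
  H (replicate l τ ++ ys) + sumOver (map (τ ∷_) (removals (replicate l τ ++ ys))) H
    ≡⟨ cong (_+_ (H (replicate l τ ++ ys)))
            (trans (sumOver-map (τ ∷_) (removals (replicate l τ ++ ys)) H) (removals-replicate (λ xs → H (τ ∷ xs)) τ l ys)) ⟩
  H (replicate l τ ++ ys) + (+ l * H (τ ∷ (replicate (ℕ.pred l) τ ++ ys)) + R)
    ≡⟨ cong (λ y → H (replicate l τ ++ ys) + (y + R)) (same-list l) ⟩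
  H (replicate l τ ++ ys) + (+ l * H (replicate l τ ++ ys) + R)
    ≡⟨ ring (H (replicate l τ ++ ys)) (+ l) R ⟩
  (1ℤ + + l) * H (replicate l τ ++ ys) + R ∎
  where
  R = sumOver (removals ys) (λ xs → H (τ ∷ (replicate l τ ++ xs)))
  same-list : ∀ l → + l * H (τ ∷ (replicate (ℕ.pred l) τ ++ ys)) ≡ + l * H (replicate l τ ++ ys)
  same-list zero    = refl
  same-list (suc l) = refl
  ring : ∀ a p r → a + (p * a + r) ≡ (1ℤ + p) * a + r
  ring = solve-∀

bothUsed-comm : ∀ p q → bothUsed p q ≡ bothUsed q p
bothUsed-comm pL pL = refl
bothUsed-comm pL pM = refl
bothUsed-comm pL pN = refl
bothUsed-comm pM pL = refl
bothUsed-comm pM pM = refl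
bothUsed-comm pM pN = refl
bothUsed-comm pN pL = refl
bothUsed-comm pN pM = refl
bothUsed-comm pN pN = refl

occupancy-comm : ∀ s o → occupancy (s , o) ≡ occupancy (o , s)
occupancy-comm nothing  nothing  = refl
occupancy-comm nothing  (just q) = refl
occupancy-comm (just p) nothing  = refl
occupancy-comm (just p) (just q) = bothUsed-comm p q

placeAt-swap : ∀ τ s o F v → placeAt τ (s , o) F v ≡ placeAt τ (o , s) F v
placeAt-swap τ s o F v = trans (+-comm (term (allowed τ (s , o)) (occupancy (s , o)) (occupancy (just τ , o)))
                                         (term (allowed τ (o , s)) (occupancy (s , o)) (occupancy (s , just τ))))
  (cong₂ _+_ (cong₂ (term (allowed τ (o , s))) (occupancy-comm s o) (occupancy-comm s (just τ)))
             (cong₂ (term (allowed τ (s , o))) (occupancy-comm s o) (occupancy-comm (just τ) o)))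
  where
  term : Bool → Occupancy → Occupancy → ℤ
  term b k k′ = if b then F (move v k k′) else 0ℤ

placeAt-same : ∀ τ p F v → placeAt τ (just p , just p) F v ≡ 0ℤ
placeAt-same τ p F v rewrite okSame∧okOpposite-edgeLabel p τ = refl

placeAt-occupancy : ∀ τ p F v → placeAt τ p F v ≡ place τ (occupancy p) F v
placeAt-occupancy τ (nothing , nothing) F v = refl
placeAt-occupancy τ (just p  , nothing) F v = refl
placeAt-occupancy τ (nothing , just p)  F v = placeAt-swap τ nothing (just p) F v
placeAt-occupancy τ (just pL , just pL) F v = trans (placeAt-same τ pL F v) (sym (placeAt-same τ pM F v))
placeAt-occupancy τ (just pL , just pM) F v = refl
placeAt-occupancy τ (just pL , just pN) F v = refl
placeAt-occupancy τ (just pM , just pL) F v = placeAt-swap τ (just pM) (just pL) F v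
placeAt-occupancy τ (just pM , just pM) F v = refl
placeAt-occupancy τ (just pM , just pN) F v = refl
placeAt-occupancy τ (just pN , just pL) F v = placeAt-swap τ (just pN) (just pL) F v
placeAt-occupancy τ (just pN , just pM) F v = placeAt-swap τ (just pN) (just pM) F v
placeAt-occupancy τ (just pN , just pN) F v = trans (placeAt-same τ pN F v) (sym (placeAt-same τ pM F v))

-- Counting proper colourings

isYes-refl : ∀ x → ⌊ x ≟ x ⌋ ≡ true
isYes-refl x = trans (isYes≗does (x ≟ x)) (dec-true (x ≟ x) refl)

isYes-≢ : ∀ {x y} → x ≢ y → ⌊ x ≟ y ⌋ ≡ false
isYes-≢ {x} {y} x≢y = trans (isYes≗does (x ≟ y)) (dec-false (x ≟ y) x≢y)

isYes-⇔ : {A B : Set} → A ⇔ B → (a? : Dec A) (b? : Dec B) → ⌊ a? ⌋ ≡ ⌊ b? ⌋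
isYes-⇔ A⇔B a? b? = trans (isYes≗does a?) (trans (does-⇔ A⇔B a? b?) (sym (isYes≗does b?)))

okPair-comm : ∀ r x y → okPair r x y ≡ okPair r y x
okPair-comm none x y = refl
okPair-comm pos  x y = cong not (isYes-⇔ (mk⇔ sym sym) (x ≟ y) (y ≟ x))
okPair-comm neg  x y = cong not (isYes-⇔ (mk⇔ flip flip) (x ≟ - y) (y ≟ - x))
  where flip : ∀ {a b} → a ≡ - b → b ≡ - a
        flip {a} {b} a≡-b = trans (sym (neg-involutive b)) (cong -_ (sym a≡-b))

i≢0⇒i≢-i : ∀ c → c ≢ 0ℤ → c ≢ - c
i≢0⇒i≢-i (+ zero)  c≢0 = λ _ → c≢0 refl
i≢0⇒i≢-i (+ suc a) c≢0 = λ ()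
i≢0⇒i≢-i -[1+ a ]  c≢0 = λ ()

okPair-zero : ∀ r → okPair r 0ℤ 0ℤ ≡ okSame r ∧ okOpposite r
okPair-zero none = refl
okPair-zero pos  = refl
okPair-zero neg  = refl

okPair-same : ∀ r c → c ≢ 0ℤ → okPair r c c ≡ okSame r
okPair-same none c c≢0 = refl
okPair-same pos  c c≢0 = cong not (isYes-refl c)
okPair-same neg  c c≢0 = cong not (isYes-≢ (i≢0⇒i≢-i c c≢0))

okPair-opposite : ∀ r c → c ≢ 0ℤ → okPair r c (- c) ≡ okOpposite r
okPair-opposite none c c≢0 = refl
okPair-opposite pos  c c≢0 = cong not (isYes-≢ (i≢0⇒i≢-i c c≢0))
okPair-opposite neg  c c≢0 = cong not (trans (cong (λ y → ⌊ c ≟ y ⌋) (neg-involutive c)) (isYes-refl c))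

okPair-unrelated : ∀ r {c c′} → c ≢ c′ → c ≢ - c′ → okPair r c c′ ≡ true
okPair-unrelated none c≢c′ c≢-c′ = refl
okPair-unrelated pos  c≢c′ c≢-c′ = cong not (isYes-≢ c≢c′)
okPair-unrelated neg  c≢c′ c≢-c′ = cong not (isYes-≢ c≢-c′)

∧-trueˡ : ∀ {a b} → a ∧ b ≡ true → a ≡ true
∧-trueˡ {true} _ = refl

-- A used colour can only be reused by the part that uses it, so (given that τ₀ was allowed) the
-- slot's new content just τ₀ carries the same constraints as the old one plus those of τ₀.
allowed-after-same : ∀ τ₀ τ s o → allowed τ₀ (s , o) ≡ true →
  allowed τ (just τ₀ , o) ≡ allowed τ (s , o) ∧ okSame (edgeLabel τ₀ τ)
allowed-after-same τ₀ τ nothing  o _  = ∧-comm (okSame (edgeLabel τ₀ τ)) (avoids τ o)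
allowed-after-same τ₀ τ (just p) o ok with okSame-edgeLabel⇒≡ p τ₀ (∧-trueˡ ok)
... | refl = absorb (okSame (edgeLabel p τ)) (avoids τ o)
  where absorb : ∀ a b → a ∧ b ≡ (a ∧ b) ∧ a
        absorb true  b = sym (∧-identityʳ b)
        absorb false b = refl

allowed-after-opposite : ∀ τ₀ τ s o → allowed τ₀ (s , o) ≡ true →
  allowed τ (o , just τ₀) ≡ allowed τ (o , s) ∧ okOpposite (edgeLabel τ₀ τ)
allowed-after-opposite τ₀ τ nothing  o _  = cong (_∧ okOpposite (edgeLabel τ₀ τ)) (sym (∧-identityʳ (fits τ o)))
allowed-after-opposite τ₀ τ (just p) o ok with okSame-edgeLabel⇒≡ p τ₀ (∧-trueˡ ok)
... | refl = trans (cong (fits τ o ∧_) (sym (∧-idem (okOpposite (edgeLabel p τ))))) (sym (∧-assoc (fits τ o) _ _))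

-- The contents of the colours +(a + 1) and -(a + 1), for each a.
State : Set
State = ℕ → Slot × Slot

_[_≔_] : State → ℕ → Slot × Slot → State
(st [ a ≔ p ]) b = if b ℕ.≡ᵇ a then p else st b

admits : Part → State → Bool → ℤ → Bool
admits τ st z (+ zero)  = z
admits τ st z (+ suc a) = allowed τ (st a)
admits τ st z -[1+ a ]  = allowed τ (swap (st a))

assign : Part → ℤ → State → State
assign τ (+ zero)  st = st
assign τ (+ suc a) st = st [ a ≔ (just τ , proj₂ (st a)) ]
assign τ -[1+ a ]  st = st [ a ≔ (proj₁ (st a) , just τ) ]

zeroAfter : ℤ → Bool → Bool
zeroAfter (+ zero) z = false
zeroAfter _        z = z

≡ᵇ-refl : ∀ a → (a ℕ.≡ᵇ a) ≡ true
≡ᵇ-refl zero    = refl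
≡ᵇ-refl (suc a) = ≡ᵇ-refl a

≡ᵇ-≢ : ∀ {a b} → a ≢ b → (a ℕ.≡ᵇ b) ≡ false
≡ᵇ-≢ {zero}  {zero}  a≢b = ⊥-elim (a≢b refl)
≡ᵇ-≢ {zero}  {suc b} a≢b = refl
≡ᵇ-≢ {suc a} {zero}  a≢b = refl
≡ᵇ-≢ {suc a} {suc b} a≢b = ≡ᵇ-≢ (a≢b ∘ cong suc)

∧-true : ∀ a {b} → b ≡ true → a ≡ a ∧ b
∧-true a refl = sym (∧-identityʳ a)

admits-assign : ∀ τ₀ τ st z c c′ → admits τ₀ st z c ≡ true →
  admits τ (assign τ₀ c st) (zeroAfter c z) c′ ≡ admits τ st z c′ ∧ okPair (edgeLabel τ₀ τ) c c′
admits-assign τ₀ τ st z (+ zero) (+ zero) ok =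
  sym (trans (cong (_∧ okPair (edgeLabel τ₀ τ) 0ℤ 0ℤ) ok)
             (trans (okPair-zero (edgeLabel τ₀ τ)) (okSame∧okOpposite-edgeLabel τ₀ τ)))
admits-assign τ₀ τ st z (+ zero) (+ suc a′) ok = ∧-true _ (okPair-unrelated (edgeLabel τ₀ τ) (λ ()) (λ ()))
admits-assign τ₀ τ st z (+ zero) -[1+ a′ ]  ok = ∧-true _ (okPair-unrelated (edgeLabel τ₀ τ) (λ ()) (λ ()))
admits-assign τ₀ τ st z (+ suc a) (+ zero) ok = ∧-true z (okPair-unrelated (edgeLabel τ₀ τ) (λ ()) (λ ()))
admits-assign τ₀ τ st z -[1+ a ]  (+ zero) ok = ∧-true z (okPair-unrelated (edgeLabel τ₀ τ) (λ ()) (λ ()))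
admits-assign τ₀ τ st z (+ suc a) (+ suc a′) ok with a′ ℕ.≟ a
... | yes refl rewrite ≡ᵇ-refl a =
  trans (allowed-after-same τ₀ τ (proj₁ (st a)) (proj₂ (st a)) ok)
        (cong (allowed τ (st a) ∧_) (sym (okPair-same (edgeLabel τ₀ τ) (+ suc a) (λ ()))))
... | no a′≢a rewrite ≡ᵇ-≢ a′≢a =
  ∧-true _ (okPair-unrelated (edgeLabel τ₀ τ) (λ eq → a′≢a (sym (ℕₚ.suc-injective (+-injective eq)))) (λ ()))
admits-assign τ₀ τ st z (+ suc a) -[1+ a′ ] ok with a′ ℕ.≟ a
... | yes refl rewrite ≡ᵇ-refl a =
  trans (allowed-after-opposite τ₀ τ (proj₁ (st a)) (proj₂ (st a)) ok)
        (cong (allowed τ (swap (st a)) ∧_) (sym (okPair-opposite (edgeLabel τ₀ τ) (+ suc a) (λ ()))))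
... | no a′≢a rewrite ≡ᵇ-≢ a′≢a =
  ∧-true _ (okPair-unrelated (edgeLabel τ₀ τ) (λ ()) (λ eq → a′≢a (sym (ℕₚ.suc-injective (+-injective eq)))))
admits-assign τ₀ τ st z -[1+ a ] (+ suc a′) ok with a′ ℕ.≟ a
... | yes refl rewrite ≡ᵇ-refl a =
  trans (allowed-after-opposite τ₀ τ (proj₂ (st a)) (proj₁ (st a)) ok)
        (cong (allowed τ (st a) ∧_) (sym (okPair-opposite (edgeLabel τ₀ τ) -[1+ a ] (λ ()))))
... | no a′≢a rewrite ≡ᵇ-≢ a′≢a =
  ∧-true _ (okPair-unrelated (edgeLabel τ₀ τ) (λ ()) (λ eq → a′≢a (sym (-[1+-injective eq))))
admits-assign τ₀ τ st z -[1+ a ] -[1+ a′ ] ok with a′ ℕ.≟ a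
... | yes refl rewrite ≡ᵇ-refl a =
  trans (allowed-after-same τ₀ τ (proj₂ (st a)) (proj₁ (st a)) ok)
        (cong (allowed τ (swap (st a)) ∧_) (sym (okPair-same (edgeLabel τ₀ τ) -[1+ a ] (λ ()))))
... | no a′≢a rewrite ≡ᵇ-≢ a′≢a =
  ∧-true _ (okPair-unrelated (edgeLabel τ₀ τ) (λ eq → a′≢a (sym (-[1+-injective eq))) (λ ()))

allᶠ : ∀ n → (Fin n → Bool) → Bool
allᶠ zero    f = true
allᶠ (suc n) f = f zero ∧ allᶠ n (f ∘ suc)

allᶠ-cong : ∀ n {f g : Fin n → Bool} → (∀ i → f i ≡ g i) → allᶠ n f ≡ allᶠ n g
allᶠ-cong zero    f≗g = refl
allᶠ-cong (suc n) f≗g = cong₂ _∧_ (f≗g zero) (allᶠ-cong n (f≗g ∘ suc))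

allᶠ-∧ : ∀ n (f g : Fin n → Bool) → allᶠ n (λ i → f i ∧ g i) ≡ allᶠ n f ∧ allᶠ n g
allᶠ-∧ zero    f g = refl
allᶠ-∧ (suc n) f g = trans (cong ((f zero ∧ g zero) ∧_) (allᶠ-∧ n (f ∘ suc) (g ∘ suc)))
                           (interchange (f zero) (g zero) (allᶠ n (f ∘ suc)) (allᶠ n (g ∘ suc)))
  where interchange : ∀ a b c d → (a ∧ b) ∧ (c ∧ d) ≡ (a ∧ c) ∧ (b ∧ d)
        interchange true  true  c d = refl
        interchange true  false c d = sym (∧-zeroʳ c)
        interchange false b c d = refl

allᶠ-true : ∀ n → allᶠ n (λ _ → true) ≡ true
allᶠ-true zero    = refl
allᶠ-true (suc n) = allᶠ-true n

and-tabulate : ∀ n {A : Set} (f : Fin n → A) (g : A → List Bool) →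
  and (concatMap g (tabulate f)) ≡ allᶠ n (λ i → and (g (f i)))
and-tabulate zero    f g = refl
and-tabulate (suc n) f g = trans (and-++ (g (f zero)) _) (cong (and (g (f zero)) ∧_) (and-tabulate n (f ∘ suc) g))
  where
  and-++ : ∀ xs ys → and (xs ++ ys) ≡ and xs ∧ and ys
  and-++ []       ys = refl
  and-++ (x ∷ xs) ys = trans (cong (x ∧_) (and-++ xs ys)) (sym (∧-assoc x (and xs) (and ys)))

and-map-tabulate : ∀ n {A : Set} (f : Fin n → A) (g : A → Bool) → and (map g (tabulate f)) ≡ allᶠ n (g ∘ f)
and-map-tabulate zero    f g = refl
and-map-tabulate (suc n) f g = cong (g (f zero) ∧_) (and-map-tabulate n (f ∘ suc) g)

properᶠ : ∀ {n} → (Fin n → Fin n → EdgeLabel) → (Fin n → ℤ) → Bool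
properᶠ {n} e κ = allᶠ n (λ v → allᶠ n (λ w → okPair (e v w) (κ v) (κ w)))

isProper≡properᶠ : ∀ G κ → isProper G κ ≡ properᶠ (edge G) κ
isProper≡properᶠ G κ = trans (and-tabulate (N G) id _)
  (allᶠ-cong (N G) (λ v → and-map-tabulate (N G) id (λ w → okPair (edge G v w) (κ v) (κ w))))

TypedBy : ∀ {n} → (Fin n → Part) → (Fin n → Fin n → EdgeLabel) → Set
TypedBy {n} τ e = (∀ v → e v v ≡ none) × (∀ v w → v ≢ w → e v w ≡ edgeLabel (τ v) (τ w))

TypedBy-suc : ∀ {n} {τ : Fin (suc n) → Part} {e} → TypedBy τ e → TypedBy (τ ∘ suc) (λ v w → e (suc v) (suc w))
TypedBy-suc (loopless , typed) = loopless ∘ suc , λ v w v≢w → typed (suc v) (suc w) (v≢w ∘ Finₚ.suc-injective)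

admissible : ∀ {n} → (Fin n → Part) → State → Bool → (Fin n → ℤ) → Bool
admissible {n} τ st z κ = allᶠ n (λ w → admits (τ w) st z (κ w))

valid : ∀ {n} → (Fin n → Part) → (Fin n → Fin n → EdgeLabel) → State → Bool → (Fin n → ℤ) → Bool
valid τ e st z κ = properᶠ e κ ∧ admissible τ st z κ

module _ {n} {τ : Fin (suc n) → Part} {e} (typed : TypedBy τ e) (κ : Fin (suc n) → ℤ) where

  private
    c = κ zero
    row = allᶠ n (λ w → okPair (edgeLabel (τ zero) (τ (suc w))) c (κ (suc w)))

  properᶠ-suc : properᶠ e κ ≡ row ∧ properᶠ (λ v w → e (suc v) (suc w)) (κ ∘ suc)
  properᶠ-suc = begin
    (okPair (e zero zero) c c ∧ allᶠ n (λ w → okPair (e zero (suc w)) c (κ (suc w))))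
      ∧ allᶠ n (λ v → okPair (e (suc v) zero) (κ (suc v)) c ∧ allᶠ n (λ w → okPair (e (suc v) (suc w)) (κ (suc v)) (κ (suc w))))
      ≡⟨ cong₂ _∧_ (cong₂ _∧_ (cong (λ r → okPair r c c) (proj₁ typed zero))
                              (allᶠ-cong n (λ w → cong (λ r → okPair r c (κ (suc w))) (proj₂ typed zero (suc w) (λ ())))))
                   (trans (allᶠ-∧ n _ _) (cong (_∧ P′) (allᶠ-cong n column))) ⟩
    row ∧ (row ∧ P′)
      ≡⟨ trans (sym (∧-assoc row row P′)) (cong (_∧ P′) (∧-idem row)) ⟩
    row ∧ P′ ∎
    where
    P′ = properᶠ (λ v w → e (suc v) (suc w)) (κ ∘ suc)
    column : ∀ v → okPair (e (suc v) zero) (κ (suc v)) c ≡ okPair (edgeLabel (τ zero) (τ (suc v))) c (κ (suc v))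
    column v = begin
      okPair (e (suc v) zero) (κ (suc v)) c
        ≡⟨ cong (λ r → okPair r (κ (suc v)) c) (proj₂ typed (suc v) zero (λ ())) ⟩
      okPair (edgeLabel (τ (suc v)) (τ zero)) (κ (suc v)) c
        ≡⟨ cong (λ r → okPair r (κ (suc v)) c) (edgeLabel-comm (τ (suc v)) (τ zero)) ⟩
      okPair (edgeLabel (τ zero) (τ (suc v))) (κ (suc v)) c ≡⟨ okPair-comm (edgeLabel (τ zero) (τ (suc v))) (κ (suc v)) c ⟩
      okPair (edgeLabel (τ zero) (τ (suc v))) c (κ (suc v)) ∎

  -- The constraints between vertex 0 and the others are exactly what assigning its colour records.
  valid-suc : ∀ st z → valid τ e st z κ
    ≡ admits (τ zero) st z c ∧ valid (τ ∘ suc) (λ v w → e (suc v) (suc w)) (assign (τ zero) c st) (zeroAfter c z) (κ ∘ suc)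
  valid-suc st z with admits (τ zero) st z c in ok
  ... | false = ∧-zeroʳ (properᶠ e κ)
  ... | true  = begin
    properᶠ e κ ∧ admissible (τ ∘ suc) st z (κ ∘ suc)
      ≡⟨ cong (_∧ admissible (τ ∘ suc) st z (κ ∘ suc)) properᶠ-suc ⟩
    (row ∧ P′) ∧ admissible (τ ∘ suc) st z (κ ∘ suc)
      ≡⟨ rearrange row P′ _ ⟩
    P′ ∧ (admissible (τ ∘ suc) st z (κ ∘ suc) ∧ row)
      ≡⟨ cong (P′ ∧_) (sym (trans (allᶠ-cong n (λ w → admits-assign (τ zero) (τ (suc w)) st z c (κ (suc w)) ok))
                                  (allᶠ-∧ n _ _))) ⟩
    P′ ∧ admissible (τ ∘ suc) (assign (τ zero) c st) (zeroAfter c z) (κ ∘ suc) ∎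
    where
    P′ = properᶠ (λ v w → e (suc v) (suc w)) (κ ∘ suc)
    rearrange : ∀ a p b → (a ∧ p) ∧ b ≡ p ∧ (b ∧ a)
    rearrange true  p b = cong (p ∧_) (sym (∧-identityʳ b))
    rearrange false p b = sym (trans (cong (p ∧_) (∧-zeroʳ b)) (∧-zeroʳ p))

countTrue : {A : Set} → (A → Bool) → List A → ℕ
countTrue P xs = length (filter (λ x → P x Bool.≟ true) xs)

countTrue-cong : {A : Set} {P Q : A → Bool} → (∀ x → P x ≡ Q x) → ∀ xs → countTrue P xs ≡ countTrue Q xs
countTrue-cong P≗Q []       = refl
countTrue-cong {P = P} {Q} P≗Q (x ∷ xs) with P x | Q x | P≗Q x
... | true  | .true  | refl = cong suc (countTrue-cong P≗Q xs)
... | false | .false | refl = countTrue-cong P≗Q xs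

countTrue-∧ : {A : Set} (b : Bool) (P : A → Bool) (xs : List A) →
              countTrue (λ x → b ∧ P x) xs ≡ (if b then countTrue P xs else 0)
countTrue-∧ true  P xs = refl
countTrue-∧ false P []       = refl
countTrue-∧ false P (x ∷ xs) = countTrue-∧ false P xs

countTrue-concatMap : {A B V : Set} (P : A → Bool) (h : B → V → A) (cs : List B) (L : List V) →
  + countTrue P (concatMap (λ c → map (h c) L) cs) ≡ sumOver cs (λ c → + countTrue (P ∘ h c) L)
countTrue-concatMap P h []       L = refl
countTrue-concatMap {A} {B} {V} P h (c ∷ cs) L = begin
  + countTrue P (map (h c) L ++ concatMap (λ c → map (h c) L) cs)
    ≡⟨ cong +_ (trans (cong length (filter-++ _ (map (h c) L) _)) (length-++ (filter _ (map (h c) L)))) ⟩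
  + (countTrue P (map (h c) L) ℕ.+ countTrue P (concatMap (λ c → map (h c) L) cs))
    ≡⟨ pos-+ (countTrue P (map (h c) L)) _ ⟩
  + countTrue P (map (h c) L) + + countTrue P (concatMap (λ c → map (h c) L) cs)
    ≡⟨ cong₂ _+_ (cong +_ (trans (cong length (filter-map (h c) L)) (length-map (h c) (filter (λ x → P (h c x) Bool.≟ true) L))))
                 (countTrue-concatMap P h cs L) ⟩
  + countTrue (P ∘ h c) L + sumOver cs (λ c → + countTrue (P ∘ h c) L) ∎
  where
  filter-map : ∀ (g : V → A) xs →
               filter (λ x → P x Bool.≟ true) (map g xs) ≡ map g (filter (λ x → P (g x) Bool.≟ true) xs)
  filter-map g []       = refl
  filter-map g (x ∷ xs) with P (g x)
  ... | true  = cong (g x ∷_) (filter-map g xs)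
  ... | false = filter-map g xs

valid-cong : ∀ {n} (τ : Fin n → Part) e st z {κ κ′ : Fin n → ℤ} → (∀ i → κ i ≡ κ′ i) →
             valid τ e st z κ ≡ valid τ e st z κ′
valid-cong {n} τ e st z κ≗κ′ = cong₂ _∧_
  (allᶠ-cong n (λ v → allᶠ-cong n (λ w → cong₂ (okPair (e v w)) (κ≗κ′ v) (κ≗κ′ w))))
  (allᶠ-cong n (λ w → cong (admits (τ w) st z) (κ≗κ′ w)))

+-if : ∀ b m → + (if b then m else 0) ≡ (if b then + m else 0ℤ)
+-if true  m = refl
+-if false m = refl

-- h c κ prepends colour c to κ; it is a parameter because allMaps builds it with a pattern lambda.
countTrue-valid-suc : ∀ {n} {τ : Fin (suc n) → Part} {e} → TypedBy τ e → ∀ st z (cs : List ℤ) (L : List (Fin n → ℤ))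
  (h : ℤ → (Fin n → ℤ) → Fin (suc n) → ℤ) → (∀ c κ → h c κ zero ≡ c) → (∀ c κ i → h c κ (suc i) ≡ κ i) →
  + countTrue (valid τ e st z) (concatMap (λ c → map (h c) L) cs)
    ≡ sumOver cs (λ c → if admits (τ zero) st z c
                        then + countTrue (valid (τ ∘ suc) (λ v w → e (suc v) (suc w)) (assign (τ zero) c st) (zeroAfter c z)) L
                        else 0ℤ)
countTrue-valid-suc {n} {τ} {e} typed st z cs L h h-zero h-suc =
  trans (countTrue-concatMap (valid τ e st z) h cs L) (sumOver-cong cs (λ c →
    trans (cong +_ (trans (countTrue-cong (split c) L) (countTrue-∧ (admits (τ zero) st z c) (valid′ c) L)))
          (+-if (admits (τ zero) st z c) _)))
  where
  valid′ : ℤ → (Fin n → ℤ) → Bool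
  valid′ c = valid (τ ∘ suc) (λ v w → e (suc v) (suc w)) (assign (τ zero) c st) (zeroAfter c z)
  split : ∀ c κ → valid τ e st z (h c κ) ≡ admits (τ zero) st z c ∧ valid′ c κ
  split c κ = begin
    valid τ e st z (h c κ)
      ≡⟨ valid-suc typed (h c κ) st z ⟩
    admits (τ zero) st z (h c κ zero) ∧ valid′ (h c κ zero) (h c κ ∘ suc)
      ≡⟨ cong (λ u → admits (τ zero) st z u ∧ valid′ u (h c κ ∘ suc)) (h-zero c κ) ⟩
    admits (τ zero) st z c ∧ valid′ c (h c κ ∘ suc)
      ≡⟨ cong (admits (τ zero) st z c ∧_) (valid-cong (τ ∘ suc) (λ v w → e (suc v) (suc w)) _ _ (h-suc c κ)) ⟩
    admits (τ zero) st z c ∧ valid′ c κ ∎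

sumBelow : ℕ → (ℕ → ℤ) → ℤ
sumBelow zero    g = 0ℤ
sumBelow (suc K) g = sumBelow K g + g K

sumBelow-cong : ∀ K {g h : ℕ → ℤ} → (∀ a → a ℕ.< K → g a ≡ h a) → sumBelow K g ≡ sumBelow K h
sumBelow-cong zero    g≗h = refl
sumBelow-cong (suc K) g≗h = cong₂ _+_ (sumBelow-cong K (λ a a<K → g≗h a (ℕₚ.m<n⇒m<1+n a<K))) (g≗h K ℕₚ.≤-refl)

sumBelow-+ : ∀ K (g h : ℕ → ℤ) → sumBelow K (λ a → g a + h a) ≡ sumBelow K g + sumBelow K h
sumBelow-+ zero    g h = refl
sumBelow-+ (suc K) g h = trans (cong (_+ (g K + h K)) (sumBelow-+ K g h)) (ring (sumBelow K g) (sumBelow K h) (g K) (h K))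
  where ring : ∀ a b c d → a + b + (c + d) ≡ a + c + (b + d)
        ring = solve-∀

sumOver-pos-upto : ∀ K (f : ℤ → ℤ) → sumOver (pos-upto K) f ≡ sumBelow K (λ a → f (+ suc a))
sumOver-pos-upto zero    f = refl
sumOver-pos-upto (suc K) f = trans (sumOver-++ (pos-upto K) (+ suc K ∷ []) f)
                                   (cong₂ _+_ (sumOver-pos-upto K f) (+-identityʳ _))

sumOver-neg-upto : ∀ K (f : ℤ → ℤ) → sumOver (map -_ (pos-upto K)) f ≡ sumBelow K (λ a → f -[1+ a ])
sumOver-neg-upto K f = trans (sumOver-map -_ (pos-upto K) f) (sumOver-pos-upto K (f ∘ -_))

δ : Occupancy → Occupancy → ℤ
δ x k = if k == x then 1ℤ else 0ℤ

occupancies : State → ℕ → Occupancy → ℤ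
occupancies st K k = sumBelow K (λ a → δ (occupancy (st a)) k)

move-δ : ∀ v x y k → move v x y k ≡ v k - δ x k + δ y k
move-δ v x y k with k == x | k == y
... | true  | true  = ring (v k)
  where ring : ∀ a → a ≡ a - 1ℤ + 1ℤ
        ring = solve-∀
... | true  | false = ring (v k)
  where ring : ∀ a → a - 1ℤ ≡ a - 1ℤ + 0ℤ
        ring = solve-∀
... | false | true  = ring (v k)
  where ring : ∀ a → a + 1ℤ ≡ a - 0ℤ + 1ℤ
        ring = solve-∀
... | false | false = ring (v k)
  where ring : ∀ a → a ≡ a - 0ℤ + 0ℤ
        ring = solve-∀

occupancies-beyond : ∀ st a p K k → K ℕ.≤ a → occupancies (st [ a ≔ p ]) K k ≡ occupancies st K k
occupancies-beyond st a p zero    k K≤a = refl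
occupancies-beyond st a p (suc K) k K<a rewrite ≡ᵇ-≢ (ℕₚ.<⇒≢ K<a) =
  cong (_+ δ (occupancy (st K)) k) (occupancies-beyond st a p K k (ℕₚ.<⇒≤ K<a))

occupancies-assign : ∀ st a p K k → a ℕ.< K →
  occupancies (st [ a ≔ p ]) K k ≡ move (occupancies st K) (occupancy (st a)) (occupancy p) k
occupancies-assign st a p K k a<K = trans (shift K a<K) (sym (move-δ (occupancies st K) (occupancy (st a)) (occupancy p) k))
  where
  shift : ∀ K → a ℕ.< K →
          occupancies (st [ a ≔ p ]) K k ≡ occupancies st K k - δ (occupancy (st a)) k + δ (occupancy p) k
  shift (suc K) a<1+K with a ℕ.≟ K
  ... | yes refl rewrite ≡ᵇ-refl a | occupancies-beyond st a p a k ℕₚ.≤-refl =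
    ring (occupancies st a k) (δ (occupancy (st a)) k) (δ (occupancy p) k)
    where ring : ∀ c o n → c + n ≡ c + o - o + n
          ring = solve-∀
  ... | no a≢K rewrite ≡ᵇ-≢ (a≢K ∘ sym) | shift K (ℕₚ.≤∧≢⇒< (ℕₚ.≤-pred a<1+K) a≢K) =
    ring (occupancies st K k) (δ (occupancy (st a)) k) (δ (occupancy p) k) (δ (occupancy (st K)) k)
    where ring : ∀ c o n x → c - o + n + x ≡ c + x - o + n
          ring = solve-∀

sumOcc-δ : ∀ x (g : Occupancy → ℤ) → sumOcc (λ k → δ x k * g k) ≡ g x
sumOcc-δ unused    g = ring (g unused)
  where ring : ∀ a → 1ℤ * a + 0ℤ + 0ℤ + 0ℤ + 0ℤ + 0ℤ + 0ℤ + 0ℤ ≡ a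
        ring = solve-∀
sumOcc-δ (half pL) g = ring (g (half pL))
  where ring : ∀ a → 0ℤ + 1ℤ * a + 0ℤ + 0ℤ + 0ℤ + 0ℤ + 0ℤ + 0ℤ ≡ a
        ring = solve-∀
sumOcc-δ (half pM) g = ring (g (half pM))
  where ring : ∀ a → 0ℤ + 0ℤ + 1ℤ * a + 0ℤ + 0ℤ + 0ℤ + 0ℤ + 0ℤ ≡ a
        ring = solve-∀
sumOcc-δ (half pN) g = ring (g (half pN))
  where ring : ∀ a → 0ℤ + 0ℤ + 0ℤ + 1ℤ * a + 0ℤ + 0ℤ + 0ℤ + 0ℤ ≡ a
        ring = solve-∀
sumOcc-δ LM        g = ring (g LM)
  where ring : ∀ a → 0ℤ + 0ℤ + 0ℤ + 0ℤ + 1ℤ * a + 0ℤ + 0ℤ + 0ℤ ≡ a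
        ring = solve-∀
sumOcc-δ LN        g = ring (g LN)
  where ring : ∀ a → 0ℤ + 0ℤ + 0ℤ + 0ℤ + 0ℤ + 1ℤ * a + 0ℤ + 0ℤ ≡ a
        ring = solve-∀
sumOcc-δ MN        g = ring (g MN)
  where ring : ∀ a → 0ℤ + 0ℤ + 0ℤ + 0ℤ + 0ℤ + 0ℤ + 1ℤ * a + 0ℤ ≡ a
        ring = solve-∀
sumOcc-δ blocked   g = ring (g blocked)
  where ring : ∀ a → 0ℤ + 0ℤ + 0ℤ + 0ℤ + 0ℤ + 0ℤ + 0ℤ + 1ℤ * a ≡ a
        ring = solve-∀

sumBelow-occupancies : ∀ st (g : Occupancy → ℤ) K →
  sumBelow K (λ a → g (occupancy (st a))) ≡ sumOcc (λ k → occupancies st K k * g k)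
sumBelow-occupancies st g zero    = sym (sumOcc-cong (λ k → *-zeroˡ (g k)))
sumBelow-occupancies st g (suc K) = begin
  sumBelow K (λ a → g (occupancy (st a))) + g (occupancy (st K))
    ≡⟨ cong₂ _+_ (sumBelow-occupancies st g K) (sym (sumOcc-δ (occupancy (st K)) g)) ⟩
  sumOcc (λ k → occupancies st K k * g k) + sumOcc (λ k → δ (occupancy (st K)) k * g k)
    ≡⟨ sym (sumOcc-+ (λ k → occupancies st K k * g k) (λ k → δ (occupancy (st K)) k * g k)) ⟩
  sumOcc (λ k → occupancies st K k * g k + δ (occupancy (st K)) k * g k)
    ≡⟨ sumOcc-cong (λ k → sym (*-distribʳ-+ (g k) (occupancies st K k) (δ (occupancy (st K)) k))) ⟩
  sumOcc (λ k → occupancies st (suc K) k * g k) ∎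

module Colourings (t : ℕ) where

  K : ℕ
  K = ⌊ t /2⌋

  count : ∀ {n} → (Fin n → Part) → (Fin n → Fin n → EdgeLabel) → State → Bool → ℕ
  count {n} τ e st z = countTrue (valid τ e st z) (allMaps (colours t) n)

  choices : Part → List Part → State → Bool → ℤ → ℤ
  choices τ₀ τs st z c =
    if admits τ₀ st z c then ways τs (occupancies (assign τ₀ c st) K) (isOdd t ∧ zeroAfter c z) else 0ℤ

  choices-zero : ∀ τ₀ τs st z b →
    sumOver (if b then (+ 0 ∷ []) else [])
            (λ c → if admits τ₀ st z c then ways τs (occupancies (assign τ₀ c st) K) (b ∧ zeroAfter c z) else 0ℤ)
    ≡ (if b ∧ z then ways τs (occupancies st K) false else 0ℤ)
  choices-zero τ₀ τs st true  true  = +-identityʳ _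
  choices-zero τ₀ τs st false true  = refl
  choices-zero τ₀ τs st z     false = refl

  choices-pair : ∀ τ₀ τs st z a → a ℕ.< K →
    choices τ₀ τs st z (+ suc a) + choices τ₀ τs st z -[1+ a ]
      ≡ placeAt τ₀ (st a) (λ w → ways τs w (isOdd t ∧ z)) (occupancies st K)
  choices-pair τ₀ τs st z a a<K = cong₂ _+_
    (cong (λ u → if allowed τ₀ (st a) then u else 0ℤ) (ways-cong τs _ (λ k → occupancies-assign st a _ K k a<K)))
    (cong (λ u → if allowed τ₀ (swap (st a)) then u else 0ℤ) (ways-cong τs _ (λ k → occupancies-assign st a _ K k a<K)))

  sumOver-choices : ∀ τ₀ τs st z →
                    sumOver (colours t) (choices τ₀ τs st z) ≡ ways (τ₀ ∷ τs) (occupancies st K) (isOdd t ∧ z)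
  sumOver-choices τ₀ τs st z = begin
    sumOver (map -_ (pos-upto K) ++ zeros ++ pos-upto K) Φ
      ≡⟨ trans (sumOver-++ (map -_ (pos-upto K)) _ Φ)
               (cong (_+_ (sumOver (map -_ (pos-upto K)) Φ)) (sumOver-++ zeros (pos-upto K) Φ)) ⟩
    sumOver (map -_ (pos-upto K)) Φ + (sumOver zeros Φ + sumOver (pos-upto K) Φ)
      ≡⟨ cong₂ (λ x y → x + (Z + y)) (sumOver-neg-upto K Φ) (sumOver-pos-upto K Φ) ⟩
    sumBelow K (λ a → Φ -[1+ a ]) + (Z + sumBelow K (λ a → Φ (+ suc a)))
      ≡⟨ ring (sumBelow K (λ a → Φ -[1+ a ])) Z (sumBelow K (λ a → Φ (+ suc a))) ⟩
    sumBelow K (λ a → Φ (+ suc a)) + sumBelow K (λ a → Φ -[1+ a ]) + Z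
      ≡⟨ cong (_+ Z) (sym (sumBelow-+ K (λ a → Φ (+ suc a)) (λ a → Φ -[1+ a ]))) ⟩
    sumBelow K (λ a → Φ (+ suc a) + Φ -[1+ a ]) + Z
      ≡⟨ cong (_+ Z) (sumBelow-cong K (λ a a<K →
           trans (choices-pair τ₀ τs st z a a<K) (placeAt-occupancy τ₀ (st a) F v))) ⟩
    sumBelow K (λ a → place τ₀ (occupancy (st a)) F v) + Z
      ≡⟨ cong₂ _+_ (sumBelow-occupancies st (λ k → place τ₀ k F v) K) (choices-zero τ₀ τs st z (isOdd t)) ⟩
    extend τ₀ F v + (if isOdd t ∧ z then ways τs v false else 0ℤ) ∎
    where
    Φ = choices τ₀ τs st z
    zeros = if isOdd t then (+ 0 ∷ []) else []
    v = occupancies st K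
    F = λ w → ways τs w (isOdd t ∧ z)
    Z = sumOver zeros Φ
    ring : ∀ a b c → a + (b + c) ≡ c + a + b
    ring = solve-∀

  count≡ways : ∀ {n} (τ : Fin n → Part) e → TypedBy τ e → ∀ st z →
               + count τ e st z ≡ ways (tabulate τ) (occupancies st K) (isOdd t ∧ z)
  count≡ways {zero}  τ e typed st z = refl
  count≡ways {suc n} τ e typed st z = begin
    + count τ e st z
      ≡⟨ countTrue-valid-suc typed st z (colours t) (allMaps (colours t) n) _ (λ _ _ → refl) (λ _ _ _ → refl) ⟩
    sumOver (colours t) (λ c → if admits (τ zero) st z c
                               then + count (τ ∘ suc) e′ (assign (τ zero) c st) (zeroAfter c z) else 0ℤ)
      ≡⟨ sumOver-cong (colours t) (λ c → cong (λ u → if admits (τ zero) st z c then u else 0ℤ)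
                                               (count≡ways (τ ∘ suc) e′ (TypedBy-suc typed) _ _)) ⟩
    sumOver (colours t) (choices (τ zero) (tabulate (τ ∘ suc)) st z)
      ≡⟨ sumOver-choices (τ zero) (tabulate (τ ∘ suc)) st z ⟩
    ways (tabulate τ) (occupancies st K) (isOdd t ∧ z) ∎
    where
    e′ : Fin n → Fin n → EdgeLabel
    e′ v w = e (suc v) (suc w)

Kedge-loopless : ∀ {k} s (i : Fin k) → Kedge s i i ≡ none
Kedge-loopless s i rewrite dec-true (i Fin.≟ i) refl = refl

Kedge-edge : ∀ {k} s {i j : Fin k} → i ≢ j → Kedge s i j ≡ s
Kedge-edge s {i} {j} i≢j rewrite dec-false (i Fin.≟ j) i≢j = refl

TypedBy-K : ∀ k s p → edgeLabel p p ≡ s → TypedBy (λ (_ : Fin k) → p) (Kedge s)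
TypedBy-K k s p refl = Kedge-loopless s , λ v w v≢w → Kedge-edge s v≢w

splitAt-injective : ∀ a {b} {v w : Fin (a ℕ.+ b)} → splitAt a v ≡ splitAt a w → v ≡ w
splitAt-injective a {b} {v} {w} eq = trans (sym (Finₚ.join-splitAt a b v)) (trans (cong (join a b) eq) (Finₚ.join-splitAt a b w))

TypedBy-∨₊ : ∀ Σ₁ Σ₂ {τ₁ : Fin (N Σ₁) → Part} {τ₂ : Fin (N Σ₂) → Part} →
  TypedBy τ₁ (edge Σ₁) → TypedBy τ₂ (edge Σ₂) → (∀ x y → edgeLabel (τ₁ x) (τ₂ y) ≡ pos) →
  TypedBy ([ τ₁ , τ₂ ]′ ∘ splitAt (N Σ₁)) (edge (Σ₁ ∨₊ Σ₂))
TypedBy-∨₊ Σ₁ Σ₂ {τ₁} {τ₂} (_ , typed₁) (_ , typed₂) cross = irr (Σ₁ ∨₊ Σ₂) , typed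
  where
  typed : ∀ v w → v ≢ w →
          edge (Σ₁ ∨₊ Σ₂) v w ≡ edgeLabel ([ τ₁ , τ₂ ]′ (splitAt (N Σ₁) v)) ([ τ₁ , τ₂ ]′ (splitAt (N Σ₁) w))
  typed v w v≢w with splitAt (N Σ₁) v in eqv | splitAt (N Σ₁) w in eqw
  ... | inj₁ x | inj₁ y = typed₁ x y (λ { refl → v≢w (splitAt-injective (N Σ₁) (trans eqv (sym eqw))) })
  ... | inj₂ x | inj₂ y = typed₂ x y (λ { refl → v≢w (splitAt-injective (N Σ₁) (trans eqv (sym eqw))) })
  ... | inj₁ x | inj₂ y = sym (cross x y)
  ... | inj₂ x | inj₁ y = sym (trans (edgeLabel-comm (τ₂ x) (τ₁ y)) (cross y x))

signedJoin : ℕ → ℕ → ℕ → SignedGraph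
signedJoin l m n = (-K l ∨₊ +K m) ∨₊ -K n

partOf : ∀ l m n → Fin (N (signedJoin l m n)) → Part
partOf l m n = [ [ const pL , const pM ]′ ∘ splitAt l , const pN ]′ ∘ splitAt (l ℕ.+ m)

TypedBy-Σ : ∀ l m n → TypedBy (partOf l m n) (edge (signedJoin l m n))
TypedBy-Σ l m n =
  TypedBy-∨₊ (-K l ∨₊ +K m) (-K n)
    (TypedBy-∨₊ (-K l) (+K m) (TypedBy-K l neg pL refl) (TypedBy-K m pos pM refl) (λ _ _ → refl))
    (TypedBy-K n neg pN refl) cross
  where
  cross : ∀ x (y : Fin n) → edgeLabel ([ const pL , const pM ]′ (splitAt l x)) pN ≡ pos
  cross x y with splitAt l x
  ... | inj₁ _ = refl
  ... | inj₂ _ = refl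

tabulate-splitAt : ∀ {A : Set} a {b} (f : Fin a ⊎ Fin b → A) →
  tabulate (f ∘ splitAt a) ≡ tabulate (f ∘ inj₁) ++ tabulate (f ∘ inj₂)
tabulate-splitAt zero    f = refl
tabulate-splitAt (suc a) f = cong (f (inj₁ zero) ∷_) (tabulate-splitAt a (f ∘ Sum.map₁ suc))

tabulate-const : ∀ {A : Set} k (x : A) → tabulate {n = k} (const x) ≡ replicate k x
tabulate-const zero    x = refl
tabulate-const (suc k) x = cong (x ∷_) (tabulate-const k x)

parts : ℕ → ℕ → ℕ → List Part
parts l m n = replicate l pL ++ (replicate m pM ++ replicate n pN)

tabulate-partOf : ∀ l m n → tabulate (partOf l m n) ≡ parts l m n
tabulate-partOf l m n = begin
  tabulate (partOf l m n)
    ≡⟨ tabulate-splitAt (l ℕ.+ m) [ [ const pL , const pM ]′ ∘ splitAt l , const pN ]′ ⟩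
  tabulate ([ const pL , const pM ]′ ∘ splitAt l) ++ tabulate {n = n} (const pN)
    ≡⟨ cong₂ _++_ (trans (tabulate-splitAt l [ const pL , const pM ]′) (cong₂ _++_ (tabulate-const l pL) (tabulate-const m pM)))
                  (tabulate-const n pN) ⟩
  (replicate l pL ++ replicate m pM) ++ replicate n pN
    ≡⟨ ++-assoc (replicate l pL) _ _ ⟩
  parts l m n ∎

emptyState : State
emptyState _ = nothing , nothing

admits-empty : ∀ τ c → admits τ emptyState true c ≡ true
admits-empty τ (+ zero)  = refl
admits-empty τ (+ suc a) = refl
admits-empty τ -[1+ a ]  = refl

f≡count : ∀ G (τ : Fin (N G) → Part) t → f G t ≡ Colourings.count t τ (edge G) emptyState true
f≡count G τ t = countTrue-cong (λ κ → begin
  isProper G κ                               ≡⟨ isProper≡properᶠ G κ ⟩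
  properᶠ (edge G) κ                          ≡⟨ ∧-true _ (all-admitted κ) ⟩
  valid τ (edge G) emptyState true κ ∎) (allMaps (colours t) (N G))
  where
  all-admitted : ∀ κ → admissible τ emptyState true κ ≡ true
  all-admitted κ = trans (allᶠ-cong (N G) (λ w → admits-empty (τ w) (κ w))) (allᶠ-true (N G))

occupancies-empty-unused : ∀ K → occupancies emptyState K unused ≡ + K
occupancies-empty-unused zero    = refl
occupancies-empty-unused (suc K) = trans (cong (_+ 1ℤ) (occupancies-empty-unused K)) (cong +_ (ℕₚ.+-comm K 1))

occupancies-empty-used : ∀ K k → (k == unused) ≡ false → occupancies emptyState K k ≡ 0ℤ
occupancies-empty-used zero    k k≠unused = refl
occupancies-empty-used (suc K) k k≠unused rewrite occupancies-empty-used K k k≠unused | k≠unused = refl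

ways-parts : ∀ l m n K → ways (parts l m n) (occupancies emptyState K) false ≡ H₁ℕ l m n (+ (K ℕ.+ K))
ways-parts l m n K = begin
  ways (parts l m n) v false
    ≡⟨ ways-LMN l m n v (unused′ (half pM) refl) (unused′ (half pN) refl) (unused′ LM refl) (unused′ LN refl) (unused′ MN refl) ⟩
  waysL m n l (v (half pL)) (v unused , v (half pL))
    ≡⟨ cong₂ (λ d e → waysL m n l d (e , d)) (unused′ (half pL) refl) (occupancies-empty-unused K) ⟩
  waysL m n l 0ℤ (+ K , 0ℤ)
    ≡⟨ waysL-H₁ l m n (+ K) ⟩
  H₁ℕ l m n (+ (K ℕ.+ K)) ∎
  where
  v = occupancies emptyState K
  unused′ = occupancies-empty-used K

f≡ways : ∀ l m n t → + f (signedJoin l m n) t ≡ ways (parts l m n) (occupancies emptyState ⌊ t /2⌋) (isOdd t)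
f≡ways l m n t = begin
  + f (signedJoin l m n) t
    ≡⟨ cong +_ (f≡count (signedJoin l m n) (partOf l m n) t) ⟩
  + Colourings.count t (partOf l m n) (edge (signedJoin l m n)) emptyState true
    ≡⟨ Colourings.count≡ways t (partOf l m n) (edge (signedJoin l m n)) (TypedBy-Σ l m n) emptyState true ⟩
  ways (tabulate (partOf l m n)) (occupancies emptyState ⌊ t /2⌋) (isOdd t ∧ true)
    ≡⟨ cong₂ (λ τs z → ways τs (occupancies emptyState ⌊ t /2⌋) z) (tabulate-partOf l m n) (∧-identityʳ (isOdd t)) ⟩
  ways (parts l m n) (occupancies emptyState ⌊ t /2⌋) (isOdd t) ∎

isOdd-double : ∀ K → isOdd (K ℕ.+ K) ≡ false
isOdd-double zero    = refl
isOdd-double (suc K) rewrite ℕₚ.+-suc K K = cong (not ∘ not) (isOdd-double K)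

f-even : ∀ l m n K → + f (signedJoin l m n) (K ℕ.+ K) ≡ H₁ (+ l) (+ m) (+ n) (+ (K ℕ.+ K))
f-even l m n K = begin
  + f (signedJoin l m n) (K ℕ.+ K)
    ≡⟨ f≡ways l m n (K ℕ.+ K) ⟩
  ways (parts l m n) (occupancies emptyState ⌊ K ℕ.+ K /2⌋) (isOdd (K ℕ.+ K))
    ≡⟨ cong₂ (λ k z → ways (parts l m n) (occupancies emptyState k) z) (sym (ℕₚ.n≡⌊n+n/2⌋ K)) (isOdd-double K) ⟩
  ways (parts l m n) (occupancies emptyState K) false
    ≡⟨ ways-parts l m n K ⟩
  H₁ℕ l m n (+ (K ℕ.+ K)) ∎

sumOver-removals-replicate : ∀ (H : List Part → ℤ) τ n →
                             sumOver (removals (replicate n τ)) H ≡ + n * H (replicate (ℕ.pred n) τ)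
sumOver-removals-replicate H τ n = begin
  sumOver (removals (replicate n τ)) H
    ≡⟨ cong (λ xs → sumOver (removals xs) H) (sym (++-identityʳ (replicate n τ))) ⟩
  sumOver (removals (replicate n τ ++ [])) H
    ≡⟨ removals-replicate H τ n [] ⟩
  + n * H (replicate (ℕ.pred n) τ ++ []) + 0ℤ
    ≡⟨ trans (+-identityʳ _) (cong (λ xs → + n * H xs) (++-identityʳ _)) ⟩
  + n * H (replicate (ℕ.pred n) τ) ∎

sumOver-removals-parts : ∀ (H : List Part → ℤ) l m n → sumOver (removals (parts l m n)) H
  ≡ + l * H (parts (ℕ.pred l) m n) + (+ m * H (parts l (ℕ.pred m) n) + + n * H (parts l m (ℕ.pred n)))
sumOver-removals-parts H l m n = begin
  sumOver (removals (parts l m n)) H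
    ≡⟨ removals-replicate H pL l _ ⟩
  + l * H (parts (ℕ.pred l) m n) + sumOver (removals (replicate m pM ++ replicate n pN)) (λ xs → H (replicate l pL ++ xs))
    ≡⟨ cong (_+_ (+ l * H (parts (ℕ.pred l) m n))) (trans (removals-replicate _ pM m _)
         (cong (_+_ (+ m * H (parts l (ℕ.pred m) n))) (sumOver-removals-replicate _ pN n))) ⟩
  + l * H (parts (ℕ.pred l) m n) + (+ m * H (parts l (ℕ.pred m) n) + + n * H (parts l m (ℕ.pred n))) ∎

*-pred : ∀ k (F : ℤ → ℤ) → + k * F (+ ℕ.pred k) ≡ + k * F (+ k - + 1)
*-pred zero    F = refl
*-pred (suc k) F = refl

oddValue : ℕ → ℕ → ℕ → (ℤ → ℤ) → ℤ → ℤ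
oddValue l m n e x = e (x - + 1) + + l * H₁ (+ l - + 1) (+ m) (+ n) (x - + 1)
                                 + + m * H₁ (+ l) (+ m - + 1) (+ n) (x - + 1)
                                 + + n * H₁ (+ l) (+ m) (+ n - + 1) (x - + 1)

f-odd : ∀ l m n K → + f (signedJoin l m n) (suc (K ℕ.+ K)) ≡ oddValue l m n (H₁ (+ l) (+ m) (+ n)) (+ suc (K ℕ.+ K))
f-odd l m n K = begin
  + f (signedJoin l m n) (suc (K ℕ.+ K))
    ≡⟨ f≡ways l m n (suc (K ℕ.+ K)) ⟩
  ways (parts l m n) (occupancies emptyState ⌊ suc (K ℕ.+ K) /2⌋) (not (isOdd (K ℕ.+ K)))
    ≡⟨ cong₂ (λ k z → ways (parts l m n) (occupancies emptyState k) z) (sym (ℕₚ.n≡⌈n+n/2⌉ K)) (cong not (isOdd-double K)) ⟩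
  ways (parts l m n) v true
    ≡⟨ ways-zero (parts l m n) v ⟩
  W (parts l m n) + sumOver (removals (parts l m n)) W
    ≡⟨ cong (_+_ (W (parts l m n))) (sumOver-removals-parts W l m n) ⟩
  W (parts l m n) + (+ l * W (parts (ℕ.pred l) m n) + (+ m * W (parts l (ℕ.pred m) n) + + n * W (parts l m (ℕ.pred n))))
    ≡⟨ cong₂ _+_ (ways-parts l m n K) (cong₂ _+_ (cong (+ l *_) (ways-parts (ℕ.pred l) m n K))
         (cong₂ _+_ (cong (+ m *_) (ways-parts l (ℕ.pred m) n K)) (cong (+ n *_) (ways-parts l m (ℕ.pred n) K)))) ⟩
  H₁ℕ l m n x + (+ l * H₁ℕ (ℕ.pred l) m n x + (+ m * H₁ℕ l (ℕ.pred m) n x + + n * H₁ℕ l m (ℕ.pred n) x))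
    ≡⟨ cong₂ (λ a b → H₁ℕ l m n x + (a + b)) (*-pred l (λ a → H₁ a (+ m) (+ n) x))
         (cong₂ _+_ (*-pred m (λ b → H₁ (+ l) b (+ n) x)) (*-pred n (λ c → H₁ (+ l) (+ m) c x))) ⟩
  H₁ℕ l m n x + (+ l * H₁ (+ l - + 1) (+ m) (+ n) x + (+ m * H₁ (+ l) (+ m - + 1) (+ n) x + + n * H₁ (+ l) (+ m) (+ n - + 1) x))
    ≡⟨ ring (H₁ℕ l m n x) _ _ _ ⟩
  H₁ℕ l m n x + + l * H₁ (+ l - + 1) (+ m) (+ n) x + + m * H₁ (+ l) (+ m - + 1) (+ n) x + + n * H₁ (+ l) (+ m) (+ n - + 1) x ∎
  where
  x = + (K ℕ.+ K)
  v = occupancies emptyState K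
  W = λ xs → ways xs v false
  ring : ∀ a b c d → a + (b + (c + d)) ≡ a + b + c + d
  ring = solve-∀

-- Polynomials

infixl 6 _+ᴾ_
infixl 7 _·ᴾ_ _*ᴾ_

_+ᴾ_ : Poly → Poly → Poly
[]       +ᴾ q        = q
(a ∷ p)  +ᴾ []       = a ∷ p
(a ∷ p)  +ᴾ (b ∷ q)  = a + b ∷ p +ᴾ q

eval-+ᴾ : ∀ p q x → eval (p +ᴾ q) x ≡ eval p x + eval q x
eval-+ᴾ []      q       x = sym (+-identityˡ _)
eval-+ᴾ (a ∷ p) []      x = sym (+-identityʳ _)
eval-+ᴾ (a ∷ p) (b ∷ q) x = trans (cong (λ y → a + b + x * y) (eval-+ᴾ p q x)) (ring a b x (eval p x) (eval q x))
  where ring : ∀ a b x P Q → a + b + x * (P + Q) ≡ a + x * P + (b + x * Q)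
        ring = solve-∀

_·ᴾ_ : ℤ → Poly → Poly
c ·ᴾ p = map (c *_) p

eval-·ᴾ : ∀ c p x → eval (c ·ᴾ p) x ≡ c * eval p x
eval-·ᴾ c []      x = sym (*-zeroʳ c)
eval-·ᴾ c (a ∷ p) x = trans (cong (λ y → c * a + x * y) (eval-·ᴾ c p x)) (ring c a x (eval p x))
  where ring : ∀ c a x P → c * a + x * (c * P) ≡ c * (a + x * P)
        ring = solve-∀

_*ᴾ_ : Poly → Poly → Poly
[]      *ᴾ q = []
(a ∷ p) *ᴾ q = (a ·ᴾ q) +ᴾ (0ℤ ∷ p *ᴾ q)

eval-*ᴾ : ∀ p q x → eval (p *ᴾ q) x ≡ eval p x * eval q x
eval-*ᴾ []      q x = refl
eval-*ᴾ (a ∷ p) q x = begin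
  eval ((a ·ᴾ q) +ᴾ (0ℤ ∷ p *ᴾ q)) x
    ≡⟨ eval-+ᴾ (a ·ᴾ q) (0ℤ ∷ p *ᴾ q) x ⟩
  eval (a ·ᴾ q) x + (0ℤ + x * eval (p *ᴾ q) x)
    ≡⟨ cong₂ (λ u w → u + (0ℤ + x * w)) (eval-·ᴾ a q x) (eval-*ᴾ p q x) ⟩
  a * eval q x + (0ℤ + x * (eval p x * eval q x))
    ≡⟨ ring a x (eval p x) (eval q x) ⟩
  (a + x * eval p x) * eval q x ∎
  where ring : ∀ a x P Q → a * Q + (0ℤ + x * (P * Q)) ≡ (a + x * P) * Q
        ring = solve-∀

IsPolynomial : (ℤ → ℤ) → Set
IsPolynomial g = ∃[ p ] ∀ x → eval p x ≡ g x

polynomial-const : ∀ c → IsPolynomial (λ _ → c)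
polynomial-const c = c ∷ [] , λ x → trans (cong (_+_ c) (*-zeroʳ x)) (+-identityʳ c)

polynomial-id : IsPolynomial id
polynomial-id = 0ℤ ∷ 1ℤ ∷ [] , ring
  where ring : ∀ x → 0ℤ + x * (1ℤ + x * 0ℤ) ≡ x
        ring = solve-∀

polynomial-+ : ∀ {f g} → IsPolynomial f → IsPolynomial g → IsPolynomial (λ x → f x + g x)
polynomial-+ (p , p≗f) (q , q≗g) = p +ᴾ q , λ x → trans (eval-+ᴾ p q x) (cong₂ _+_ (p≗f x) (q≗g x))

polynomial-* : ∀ {f g} → IsPolynomial f → IsPolynomial g → IsPolynomial (λ x → f x * g x)
polynomial-* (p , p≗f) (q , q≗g) = p *ᴾ q , λ x → trans (eval-*ᴾ p q x) (cong₂ _*_ (p≗f x) (q≗g x))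

polynomial-cong : ∀ {f g} → IsPolynomial f → (∀ x → f x ≡ g x) → IsPolynomial g
polynomial-cong (p , p≗f) f≗g = p , λ x → trans (p≗f x) (f≗g x)

polynomial-∘ : ∀ {f g} → IsPolynomial f → IsPolynomial g → IsPolynomial (f ∘ g)
polynomial-∘ {f} {g} (p , p≗f) g-poly = polynomial-cong (eval-∘ p) (λ x → p≗f (g x))
  where
  eval-∘ : ∀ p → IsPolynomial (λ x → eval p (g x))
  eval-∘ []      = polynomial-const 0ℤ
  eval-∘ (c ∷ p) = polynomial-+ (polynomial-const c) (polynomial-* g-poly (eval-∘ p))

polynomial-sumTo : ∀ n {g : ℕ → ℤ → ℤ} → (∀ k → IsPolynomial (g k)) →
                   IsPolynomial (λ x → sumTo n (λ k → g k x))
polynomial-sumTo zero    g-poly = g-poly 0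
polynomial-sumTo (suc n) g-poly = polynomial-+ (polynomial-sumTo n g-poly) (g-poly (suc n))

polynomial-falling : ∀ {f} n → IsPolynomial f → IsPolynomial (λ x → falling (f x) n)
polynomial-falling zero    f-poly = polynomial-const 1ℤ
polynomial-falling (suc n) f-poly = polynomial-* (polynomial-falling n f-poly) (polynomial-+ f-poly (polynomial-const (- + n)))

polynomial-falling2 : ∀ {f} n → IsPolynomial f → IsPolynomial (λ x → falling2 (f x) n)
polynomial-falling2 zero    f-poly = polynomial-const 1ℤ
polynomial-falling2 (suc n) f-poly =
  polynomial-* (polynomial-falling2 n f-poly) (polynomial-+ f-poly (polynomial-const (- + (2 ℕ.* n))))

divide : Poly → ℤ → Poly
divide []           r = []
divide (c ∷ [])     r = []
divide (c ∷ d ∷ ds) r = eval (d ∷ ds) r ∷ divide (d ∷ ds) r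

length-divide : ∀ c ds r → length (divide (c ∷ ds) r) ≡ length ds
length-divide c []       r = refl
length-divide c (d ∷ ds) r = cong suc (length-divide d ds r)

eval-divide : ∀ p r x → eval p x ≡ eval p r + (x - r) * eval (divide p r) x
eval-divide []           r x = ring x r
  where ring : ∀ x r → 0ℤ ≡ 0ℤ + (x - r) * 0ℤ
        ring = solve-∀
eval-divide (c ∷ [])     r x = ring c x r
  where ring : ∀ c x r → c + x * 0ℤ ≡ c + r * 0ℤ + (x - r) * 0ℤ
        ring = solve-∀
eval-divide (c ∷ d ∷ ds) r x =
  trans (cong (λ y → c + x * y) (eval-divide (d ∷ ds) r x)) (ring c x r (eval (d ∷ ds) r) (eval (divide (d ∷ ds) r) x))
  where ring : ∀ c x r E Q → c + x * (E + (x - r) * Q) ≡ c + r * E + (x - r) * (E + x * Q)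
        ring = solve-∀

-- Dividing by x - a 0 leaves a shorter polynomial vanishing at all a (suc i), since a (suc i) ≠ a 0.
vanishing : ∀ n p → length p ≡ n → (a : ℕ → ℤ) → Injective _≡_ _≡_ a →
            (∀ i → eval p (a i) ≡ 0ℤ) → ∀ x → eval p x ≡ 0ℤ
vanishing n       []       _   a inj roots x = refl
vanishing (suc n) (c ∷ ds) len a inj roots x = begin
  eval (c ∷ ds) x                             ≡⟨ eval-divide (c ∷ ds) (a 0) x ⟩
  eval (c ∷ ds) (a 0) + (x - a 0) * eval q x  ≡⟨ cong₂ (λ u w → u + (x - a 0) * w) (roots 0)
                                                        (vanishing n q len′ (a ∘ suc) (ℕₚ.suc-injective ∘ inj) q-roots x) ⟩
  0ℤ + (x - a 0) * 0ℤ                         ≡⟨ trans (+-identityˡ _) (*-zeroʳ (x - a 0)) ⟩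
  0ℤ                                          ∎
  where
  q = divide (c ∷ ds) (a 0)
  len′ = trans (length-divide c ds (a 0)) (ℕₚ.suc-injective len)
  q-roots : ∀ i → eval q (a (suc i)) ≡ 0ℤ
  q-roots i with i*j≡0⇒i≡0∨j≡0 (a (suc i) - a 0) (begin
      (a (suc i) - a 0) * eval q (a (suc i))                    ≡⟨ sym (+-identityˡ _) ⟩
      0ℤ + (a (suc i) - a 0) * eval q (a (suc i))               ≡⟨ cong (λ u → u + (a (suc i) - a 0) * eval q (a (suc i))) (sym (roots 0)) ⟩
      eval (c ∷ ds) (a 0) + (a (suc i) - a 0) * eval q (a (suc i)) ≡⟨ sym (eval-divide (c ∷ ds) (a 0) (a (suc i))) ⟩
      eval (c ∷ ds) (a (suc i))                                 ≡⟨ roots (suc i) ⟩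
      0ℤ ∎)
  ... | inj₁ a₁-a₀≡0 with inj (i-j≡0⇒i≡j (a (suc i)) (a 0) a₁-a₀≡0)
  ...   | ()
  q-roots i | inj₂ q≡0 = q≡0

polynomial-unique : ∀ p {g} → IsPolynomial g → (a : ℕ → ℤ) → Injective _≡_ _≡_ a →
                    (∀ i → eval p (a i) ≡ g (a i)) → ∀ x → eval p x ≡ g x
polynomial-unique p {g} (q , q≗g) a inj agree x =
  i-j≡0⇒i≡j (eval p x) (g x) (trans (sym (eval-d x)) (vanishing _ d refl a inj d-roots x))
  where
  d = p +ᴾ (- 1ℤ ·ᴾ q)
  eval-d : ∀ y → eval d y ≡ eval p y - g y
  eval-d y = begin
    eval d y                       ≡⟨ eval-+ᴾ p (- 1ℤ ·ᴾ q) y ⟩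
    eval p y + eval (- 1ℤ ·ᴾ q) y  ≡⟨ cong (_+_ (eval p y)) (trans (eval-·ᴾ (- 1ℤ) q y) (cong (- 1ℤ *_) (q≗g y))) ⟩
    eval p y + - 1ℤ * g y          ≡⟨ cong (_+_ (eval p y)) (-1*i≡-i (g y)) ⟩
    eval p y - g y                 ∎
  d-roots : ∀ i → eval d (a i) ≡ 0ℤ
  d-roots i = trans (eval-d (a i)) (trans (cong (_-_ (eval p (a i))) (sym (agree i))) (+-inverseʳ (eval p (a i))))

H₁ℕ-polynomial : ∀ l m n → IsPolynomial (H₁ℕ l m n)
H₁ℕ-polynomial l m n =
  polynomial-sumTo l (λ i → polynomial-sumTo n (λ j → polynomial-sumTo (i ℕ.⊓ j) (λ k →
    polynomial-* (polynomial-* (polynomial-const (+ ((k !) ℕ.* (i C k) ℕ.* (j C k) ℕ.* S l i ℕ.* S n j)))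
                               (polynomial-falling2 (i ℕ.+ j ℕ.∸ k) polynomial-id))
                 (polynomial-falling m (polynomial-+ polynomial-id (polynomial-const (- + (i ℕ.+ j))))))))

H₁-polynomial : ∀ a b c → IsPolynomial (H₁ a b c)
H₁-polynomial (+ l)    (+ m)    (+ n)    = H₁ℕ-polynomial l m n
H₁-polynomial -[1+ _ ] b        c        = polynomial-const 0ℤ
H₁-polynomial (+ l)    -[1+ _ ] c        = polynomial-const 0ℤ
H₁-polynomial (+ l)    (+ m)    -[1+ _ ] = polynomial-const 0ℤ

oddValue-cong : ∀ l m n {e e′ : ℤ → ℤ} → (∀ y → e y ≡ e′ y) → ∀ x → oddValue l m n e x ≡ oddValue l m n e′ x
oddValue-cong l m n e≗e′ x = cong (λ y → y + + l * H₁ (+ l - + 1) (+ m) (+ n) (x - + 1)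
                                            + + m * H₁ (+ l) (+ m - + 1) (+ n) (x - + 1)
                                            + + n * H₁ (+ l) (+ m) (+ n - + 1) (x - + 1)) (e≗e′ (x - + 1))

oddValue-polynomial : ∀ l m n {e} → IsPolynomial e → IsPolynomial (oddValue l m n e)
oddValue-polynomial l m n e-poly =
  polynomial-+ (polynomial-+ (polynomial-+ (at-pred e-poly) (scaled l (H₁-polynomial (+ l - + 1) (+ m) (+ n))))
                             (scaled m (H₁-polynomial (+ l) (+ m - + 1) (+ n))))
               (scaled n (H₁-polynomial (+ l) (+ m) (+ n - + 1)))
  where
  at-pred : ∀ {g} → IsPolynomial g → IsPolynomial (λ x → g (x - + 1))
  at-pred g-poly = polynomial-∘ g-poly (polynomial-+ polynomial-id (polynomial-const (- + 1)))
  scaled : ∀ k {g} → IsPolynomial g → IsPolynomial (λ x → + k * g (x - + 1))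
  scaled k g-poly = polynomial-* (polynomial-const (+ k)) (at-pred g-poly)

double-injective : Injective _≡_ _≡_ (λ K → + (K ℕ.+ K))
double-injective {i} {j} eq = trans (ℕₚ.n≡⌊n+n/2⌋ i) (trans (cong ⌊_/2⌋ (+-injective eq)) (sym (ℕₚ.n≡⌊n+n/2⌋ j)))

suc-double-injective : Injective _≡_ _≡_ (λ K → + suc (K ℕ.+ K))
suc-double-injective {i} {j} eq = trans (ℕₚ.n≡⌈n+n/2⌉ i) (trans (cong ⌊_/2⌋ (+-injective eq)) (sym (ℕₚ.n≡⌈n+n/2⌉ j)))

proposition3p2 : (l m n : ℕ) → (E O : Poly)
    → (∀ (λ' : ℕ) → isOdd λ' ≡ false → + f ((-K l ∨₊ +K m) ∨₊ -K n) λ' ≡ eval E (+ λ'))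
    → (∀ (λ' : ℕ) → isOdd λ' ≡ true → + f ((-K l ∨₊ +K m) ∨₊ -K n) λ' ≡ eval O (+ λ'))
    → (∀ (x : ℤ) → eval E x ≡ H₁ (+ l) (+ m) (+ n) x)
      × (∀ (x : ℤ) → eval O x ≡ eval E (x - + 1)
                                 + + l * H₁ (+ l - + 1) (+ m) (+ n) (x - + 1)
                                 + + m * H₁ (+ l) (+ m - + 1) (+ n) (x - + 1)
                                 + + n * H₁ (+ l) (+ m) (+ n - + 1) (x - + 1))
proposition3p2 l m n E O hE hO = evenPart , oddPart
  where
  evenPart : ∀ x → eval E x ≡ H₁ (+ l) (+ m) (+ n) x
  evenPart = polynomial-unique E (H₁-polynomial (+ l) (+ m) (+ n)) (λ K → + (K ℕ.+ K)) double-injective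
    (λ K → trans (sym (hE (K ℕ.+ K) (isOdd-double K))) (f-even l m n K))
  oddPart : ∀ x → eval O x ≡ oddValue l m n (eval E) x
  oddPart = polynomial-unique O (oddValue-polynomial l m n (E , λ _ → refl)) (λ K → + ℕ.suc (K ℕ.+ K)) suc-double-injective
    (λ K → trans (sym (hO (ℕ.suc (K ℕ.+ K)) (cong not (isOdd-double K))))
                 (trans (f-odd l m n K) (oddValue-cong l m n (sym ∘ evenPart) (+ ℕ.suc (K ℕ.+ K)))))
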